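{- (1) For $v\equiv 1\pmod 4$, there exists a ZCPS-Wh$(v)$ if and only if there exists a PS$(v)$. (2) For $v\equiv 3\pmod 4$, there exists a ZCPS-Wh$(v+1)$ if and only if there exists an APS$(v,\alpha,\alpha)$ for some nonzero $\alpha\in\mathbb{Z}_v$.
   Context: A whist tournament Wh$(n)$ for $n=4m$ (resp. $4m+1$) is a schedule of games $(a,b,c,d)$, where $\{a,c\},\{b,d\}$ are partner pairs and $\{a,b\},\{c,d\},\{a,d\},\{b,c\}$ are opponent pairs, such that the games are arranged into $4m-1$ (resp. $4m+1$) rounds of $m$ games each, each player plays in exactly one game in each round (resp. in all rounds but one), each player partners every other player exactly once, and has every other player as an opponent exactly twice. A Wh$(4m+1)$ is $\mathbb{Z}$-cyclic if the players are $\mathbb{Z}_{4m+1}$ and round $j+1$ is obtained from round $j$ by adding $1$ to each element, with $0$ missing from the initial round; a Wh$(4m)$ is $\mathbb{Z}$-cyclic if the players are $\mathbb{Z}_{4m-1}\cup\{\infty\}$ and rounds are obtained likewise with $\infty+1=\infty$. A ZCPS-Wh$(n)$ is a $\mathbb{Z}$-cyclic Wh$(n)$ whose initial-round partner pairs form $\{\{x,-x\}:x\in\mathbb{Z}_n\setminus\{0\}\}$ when $n\equiv1\pmod4$, or $\{\{x,-x\}:x\in\mathbb{Z}_{n-1}\setminus\{0\}\}\cup\{\{\infty,0\}\}$ when $n\equiv0\pmod4$. PS$(v)$ ($v\equiv1\pmod4$): a set $\mathcal S$ of $(v-1)/4$ unordered pairs from $\mathbb{Z}_v$ with $\bigcup_{\{x,y\}\in\mathcal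 S}\pm\{x,y\}=\bigcup_{\{x,y\}\in\mathcal S}\pm\{x-y,x+y\}=\mathbb{Z}_v\setminus\{0\}$. APS$(v,\alpha,\beta)$ ($v\equiv3\pmod4$, $\alpha,\beta\neq0$): a set $\mathcal S$ of $(v-3)/4$ unordered pairs from $\mathbb{Z}_v$ with $\bigcup\pm\{x,y\}=\mathbb{Z}_v\setminus\{0,\pm\alpha\}$ and $\bigcup\pm\{x-y,x+y\}=\mathbb{Z}_v\setminus\{0,\pm\beta\}$. -}

module Defs where

open import Data.Nat using (ℕ; zero; suc; _+_; _*_; _∸_; NonZero)
open import Data.Nat.DivMod using (_mod_)
open import Data.Fin using (Fin; toℕ)
import Data.Fin.Properties as FinP
open import Data.Maybe using (Maybe; just; nothing)
import Data.Maybe.Properties as MaybeP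
open import Data.List using (List; []; _∷_; length; filter; map; concatMap; allFin)
open import Data.Nat.ListAction using (sum)
open import Data.List.Relation.Unary.Any using (Any)
open import Data.Vec using (Vec; toList; lookup)
import Data.Vec as Vec
open import Data.Product using (_×_; _,_; ∃-syntax)
open import Data.Sum using (_⊎_)
open import Relation.Nullary using (¬_; Dec)
open import Relation.Nullary.Decidable using (_×-dec_; _⊎-dec_)
open import Relation.Unary using (Decidable)
open import Relation.Binary using (DecidableEquality)
open import Relation.Binary.PropositionalEquality using (_≡_; _≢_)
open import Function.Bundles using (_⇔_)

-- Arithmetic in ℤ_v, with ℤ_v represented as Fin v (v ≥ 1).

infixl 6 _⊕_ _⊖_

0ᵥ : ∀ {v} .{{_ : NonZero v}} → Fin v
0ᵥ {v} = 0 mod v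

_⊕_ : ∀ {v} .{{_ : NonZero v}} → Fin v → Fin v → Fin v
_⊕_ {v} x y = (toℕ x + toℕ y) mod v

⊝_ : ∀ {v} .{{_ : NonZero v}} → Fin v → Fin v
⊝_ {v} x = (v ∸ toℕ x) mod v

_⊖_ : ∀ {v} .{{_ : NonZero v}} → Fin v → Fin v → Fin v
x ⊖ y = x ⊕ (⊝ y)

Game : Set → Set
Game P = P × P × P × P

partnerPairs : ∀ {P : Set} → Game P → List (P × P)
partnerPairs (a , b , c , d) = (a , c) ∷ (b , d) ∷ []

opponentPairs : ∀ {P : Set} → Game P → List (P × P)
opponentPairs (a , b , c , d) = (a , b) ∷ (c , d) ∷ (a , d) ∷ (b , c) ∷ []

IsPair : ∀ {P : Set} → P → P → P × P → Set
IsPair x y (p , q) = (x ≡ p × y ≡ q) ⊎ (x ≡ q × y ≡ p)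

InGame : ∀ {P : Set} → P → Game P → Set
InGame x (a , b , c , d) = x ≡ a ⊎ x ≡ b ⊎ x ≡ c ⊎ x ≡ d

Distinct4 : ∀ {P : Set} → Game P → Set
Distinct4 (a , b , c , d) = a ≢ b × a ≢ c × a ≢ d × b ≢ c × b ≢ d × c ≢ d

module _ {P : Set} (_≟_ : DecidableEquality P) where

  isPair? : ∀ x y → Decidable (IsPair {P} x y)
  isPair? x y (p , q) = ((x ≟ p) ×-dec (y ≟ q)) ⊎-dec ((x ≟ q) ×-dec (y ≟ p))

  inGame? : ∀ x → Decidable (InGame {P} x)
  inGame? x (a , b , c , d) = (x ≟ a) ⊎-dec (x ≟ b) ⊎-dec (x ≟ c) ⊎-dec (x ≟ d)

  module _ {R m : ℕ} (rounds : Fin R → Vec (Game P) m) where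

    allGames : List (Game P)
    allGames = concatMap (λ r → toList (rounds r)) (allFin R)

    partnerCount : P → P → ℕ
    partnerCount x y =
      sum (map (λ g → length (filter (isPair? x y) (partnerPairs g))) allGames)

    opponentCount : P → P → ℕ
    opponentCount x y =
      sum (map (λ g → length (filter (isPair? x y) (opponentPairs g))) allGames)

    gamesOf : P → Fin R → ℕ
    gamesOf x r = length (filter (inGame? x) (toList (rounds r)))

    WhPairConditions : Set
    WhPairConditions =
      (∀ r i → Distinct4 (lookup (rounds r) i))
      × (∀ x y → x ≢ y → partnerCount x y ≡ 1)
      × (∀ x y → x ≢ y → opponentCount x y ≡ 2)

    IsWh-4m : Set
    IsWh-4m = WhPairConditions × (∀ x r → gamesOf x r ≡ 1)

    IsWh-4m+1 : Set
    IsWh-4m+1 = WhPairConditions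
      × (∀ x → ∃[ r₀ ] (gamesOf x r₀ ≡ 0 × (∀ r → r ≢ r₀ → gamesOf x r ≡ 1)))

translate : ∀ {v} .{{_ : NonZero v}} → Fin v → Game (Fin v) → Game (Fin v)
translate r (a , b , c , d) = (a ⊕ r , b ⊕ r , c ⊕ r , d ⊕ r)

-- players ℤ_v ∪ {∞}, with ∞ = nothing and ∞ + r = ∞
translate∞ : ∀ {v} .{{_ : NonZero v}} → Fin v → Game (Maybe (Fin v)) → Game (Maybe (Fin v))
translate∞ r (a , b , c , d) = (sh a , sh b , sh c , sh d)
  where
  sh : Maybe _ → Maybe _
  sh nothing  = nothing
  sh (just x) = just (x ⊕ r)

IsInitialPartnerPair : ∀ {P : Set} {m} → Vec (Game P) m → P → P → Set
IsInitialPartnerPair I p q = ∃[ i ] Any (IsPair p q) (partnerPairs (lookup I i))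

-- Case n = v = 4m+1: players ℤ_v, rounds r ↦ I + r (r ∈ ℤ_v), 0 not in I.
roundsZ : ∀ {m v} .{{_ : NonZero v}} → Vec (Game (Fin v)) m → Fin v → Vec (Game (Fin v)) m
roundsZ I r = Vec.map (translate r) I

IsZCyclicWh-4m+1 : (m : ℕ) → Vec (Game (Fin (suc (4 * m)))) m → Set
IsZCyclicWh-4m+1 m I =
  IsWh-4m+1 FinP._≟_ (roundsZ I) × (∀ i → ¬ InGame 0ᵥ (lookup I i))

IsZCPSWh-4m+1 : (m : ℕ) → Vec (Game (Fin (suc (4 * m)))) m → Set
IsZCPSWh-4m+1 m I = IsZCyclicWh-4m+1 m I
  × (∀ p q → IsInitialPartnerPair I p q ⇔ (∃[ x ] (x ≢ 0ᵥ × IsPair p q (x , ⊝ x))))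

ZCPSWh-4m+1 : ℕ → Set
ZCPSWh-4m+1 m = ∃[ I ] IsZCPSWh-4m+1 m I

-- Case n = v + 1 with v = 4k+3 (so n = 4(k+1)), players ℤ_v ∪ {∞},
-- v rounds r ↦ I + r, each of k+1 games.
roundsZ∞ : ∀ {m v} .{{_ : NonZero v}} → Vec (Game (Maybe (Fin v))) m → Fin v → Vec (Game (Maybe (Fin v))) m
roundsZ∞ I r = Vec.map (translate∞ r) I

IsZCyclicWh-4k+4 : (k : ℕ) → Vec (Game (Maybe (Fin (suc (4 * k + 2))))) (suc k) → Set
IsZCyclicWh-4k+4 k I = IsWh-4m (MaybeP.≡-dec FinP._≟_) (roundsZ∞ I)

IsZCPSWh-4k+4 : (k : ℕ) → Vec (Game (Maybe (Fin (suc (4 * k + 2))))) (suc k) → Set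
IsZCPSWh-4k+4 k I = IsZCyclicWh-4k+4 k I
  × (∀ p q → IsInitialPartnerPair I p q ⇔
       ((∃[ x ] (x ≢ 0ᵥ × IsPair p q (just x , just (⊝ x))))
        ⊎ IsPair p q (nothing , just 0ᵥ)))

ZCPSWh-4k+4 : ℕ → Set
ZCPSWh-4k+4 k = ∃[ I ] IsZCPSWh-4k+4 k I

_∈±_ : ∀ {v} .{{_ : NonZero v}} → Fin v → Fin v × Fin v → Set
z ∈± (x , y) = z ≡ x ⊎ z ≡ y ⊎ z ≡ ⊝ x ⊎ z ≡ ⊝ y

diffSum : ∀ {v} .{{_ : NonZero v}} → Fin v × Fin v → Fin v × Fin v
diffSum (x , y) = (x ⊖ y , x ⊕ y)

IsPS : (m : ℕ) → Vec (Fin (suc (4 * m)) × Fin (suc (4 * m))) m → Set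
IsPS m S =
  (∀ z → (∃[ i ] z ∈± lookup S i) ⇔ z ≢ 0ᵥ)
  × (∀ z → (∃[ i ] z ∈± diffSum (lookup S i)) ⇔ z ≢ 0ᵥ)

PS : ℕ → Set
PS m = ∃[ S ] IsPS m S

IsAPS : (k : ℕ) → (α β : Fin (suc (4 * k + 2))) → Vec (Fin (suc (4 * k + 2)) × Fin (suc (4 * k + 2))) k → Set
IsAPS k α β S =
  (∀ z → (∃[ i ] z ∈± lookup S i) ⇔ (z ≢ 0ᵥ × z ≢ α × z ≢ ⊝ α))
  × (∀ z → (∃[ i ] z ∈± diffSum (lookup S i)) ⇔ (z ≢ 0ᵥ × z ≢ β × z ≢ ⊝ β))

APS : (k : ℕ) → (α β : Fin (suc (4 * k + 2))) → Set
APS k α β = ∃[ S ] IsAPS k α β S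

-- Both constructions go through the initial round: a PS S yields the base games (x, y, -x, -y) for
-- {x, y} ∈ S, and an APS(v, α, α) yields these together with (∞, α, 0, -α); conversely, the initial
-- partner pairs of a ZCPS tournament are the pairs {x, -x}, so its initial games have this shape.
-- In the cyclic schedule, p ≠ q are partners (resp. opponents) once for each initial partner
-- (resp. opponent) pair {a, b} with a - b = ±(q - p).  The partner pairs of (x, y, -x, -y) give the
-- differences ±2x, ±2y and its opponent pairs give ±(x - y), ±(x + y), each twice.  Since v is odd
-- we can halve, so p and q are partners as often as (q - p)/2 lies in ±S, and opponents twice as
-- often as q - p lies among the ±-differences of S.  Finally, m pairs have 4m signed entries, so
-- covering the 4m admissible residues forces every multiplicity to be exactly one.

module Submission where

open import Defs
import Data.Nat.Properties as ℕP
open import Algebra.Bundles using (CommutativeRing)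
open import Algebra.Properties.CommutativeMonoid.Sum ℕP.+-0-commutativeMonoid
  using (sum-syntax; ∑-distrib-+; ∑-comm; sum-cong-≗)
open import Algebra.Structures using (IsCommutativeRing)
open import Algebra.Solver.Ring.AlmostCommutativeRing
  using (AlmostCommutativeRing; fromCommutativeRing; _-Raw-AlmostCommutative⟶_)
import Algebra.Solver.Ring
open import Data.Empty using (⊥-elim; ⊥-elim-irr)
open import Data.Fin using (Fin; zero; suc; toℕ; punchIn; punchOut)
open import Data.Fin.Patterns using (0F; 1F; 2F; 3F)
import Data.Fin.Properties as FinP
open import Data.Integer as ℤ using (ℤ)
import Data.Integer.Properties as ℤP
open import Data.List using (List; []; _∷_; _++_; length; filter; map; concatMap; tabulate; allFin)
import Data.List.Properties as ListProp
open import Data.List.Relation.Unary.Any using (Any; here; there)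
open import Data.Maybe using (Maybe; just; nothing)
import Data.Maybe.Properties as MaybeP
open import Data.Nat using (ℕ; zero; suc; _+_; _*_; _∸_; _%_; _≤_; _<_; z≤n; s≤s; NonZero)
open import Data.Nat.DivMod
  using (_mod_; m%n<n; m<n⇒m%n≡m; %-distribˡ-+; %-distribˡ-*; n%n≡0; m*n%n≡0; [m+n]%n≡m%n)
open import Data.Nat.ListAction using () renaming (sum to listSum)
import Data.Nat.ListAction.Properties as ListP
open import Data.Nat.Tactic.RingSolver using (solve-∀)
open import Data.Product using (_×_; _,_; proj₁; proj₂; ∃-syntax)
import Data.Product as Prod
open import Data.Sum using (_⊎_; inj₁; inj₂)
import Data.Sum as Sum
open import Data.Vec using (Vec; toList; lookup)
import Data.Vec as Vec
import Data.Vec.Properties as VecP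
open import Function using (_∘_; id)
open import Function.Bundles using (_⇔_; mk⇔; Equivalence)
open import Function.Properties.Equivalence using () renaming (trans to ⇔-trans)
open import Relation.Binary using (DecidableEquality)
open import Relation.Binary.PropositionalEquality
open import Relation.Nullary using (¬_; Dec; yes; no)
open import Relation.Nullary.Decidable using (¬?; _×-dec_; _⊎-dec_)
open import Relation.Unary using (Decidable)

-- Indicators and finite sums

𝟙 : ∀ {a} {A : Set a} → Dec A → ℕ
𝟙 (yes _) = 1
𝟙 (no _)  = 0

module _ {a} {A : Set a} where

  𝟙-yes : A → (d : Dec A) → 𝟙 d ≡ 1
  𝟙-yes _ (yes _) = refl
  𝟙-yes x (no ¬x) = ⊥-elim (¬x x)

  𝟙-no : ¬ A → (d : Dec A) → 𝟙 d ≡ 0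
  𝟙-no ¬x (yes x) = ⊥-elim (¬x x)
  𝟙-no _  (no _)  = refl

  𝟙-pos : (d : Dec A) → 0 < 𝟙 d → A
  𝟙-pos (yes x) _ = x

  𝟙≤1 : (d : Dec A) → 𝟙 d ≤ 1
  𝟙≤1 (yes _) = s≤s z≤n
  𝟙≤1 (no _)  = z≤n

𝟙-cong : ∀ {a b} {A : Set a} {B : Set b} → A ⇔ B → (d : Dec A) (e : Dec B) → 𝟙 d ≡ 𝟙 e
𝟙-cong A⇔B (yes _) (yes _) = refl
𝟙-cong A⇔B (yes x) (no ¬y) = ⊥-elim (¬y (Equivalence.to A⇔B x))
𝟙-cong A⇔B (no ¬x) (yes y) = ⊥-elim (¬x (Equivalence.from A⇔B y))
𝟙-cong A⇔B (no _)  (no _)  = refl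

𝟙-⊎ : ∀ {a b} {A : Set a} {B : Set b} → ¬ (A × B) → (d : Dec A) (e : Dec B) → 𝟙 (d ⊎-dec e) ≡ 𝟙 d + 𝟙 e
𝟙-⊎ disj (yes x) (yes y) = ⊥-elim (disj (x , y))
𝟙-⊎ disj (yes _) (no _)  = refl
𝟙-⊎ disj (no _)  (yes _) = refl
𝟙-⊎ disj (no _)  (no _)  = refl

length-filter-∷ : ∀ {a p} {A : Set a} {P : A → Set p} (P? : Decidable P) x xs →
                  length (filter P? (x ∷ xs)) ≡ 𝟙 (P? x) + length (filter P? xs)
length-filter-∷ P? x xs with P? x
... | yes _ = refl
... | no _  = refl

length-filter-cong : ∀ {a p q} {A : Set a} {P : A → Set p} {Q : A → Set q} (P? : Decidable P) (Q? : Decidable Q) →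
                     (∀ x → 𝟙 (P? x) ≡ 𝟙 (Q? x)) → ∀ xs → length (filter P? xs) ≡ length (filter Q? xs)
length-filter-cong P? Q? eq []       = refl
length-filter-cong P? Q? eq (x ∷ xs) = begin
  length (filter P? (x ∷ xs))          ≡⟨ length-filter-∷ P? x xs ⟩
  𝟙 (P? x) + length (filter P? xs)     ≡⟨ cong₂ _+_ (eq x) (length-filter-cong P? Q? eq xs) ⟩
  𝟙 (Q? x) + length (filter Q? xs)     ≡⟨ length-filter-∷ Q? x xs ⟨
  length (filter Q? (x ∷ xs))          ∎
  where open ≡-Reasoning

length-filter-toList : ∀ {a p} {A : Set a} {P : A → Set p} (P? : Decidable P) {m} (xs : Vec A m) →
                       length (filter P? (toList xs)) ≡ ∑[ i < m ] 𝟙 (P? (lookup xs i))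
length-filter-toList P? Vec.[]       = refl
length-filter-toList P? (x Vec.∷ xs) =
  trans (length-filter-∷ P? x (toList xs)) (cong (𝟙 (P? x) +_) (length-filter-toList P? xs))

module _ {a} {A : Set a} where

  listSum-map-tabulate : (f : A → ℕ) {n : ℕ} (g : Fin n → A) → listSum (map f (tabulate g)) ≡ ∑[ i < n ] f (g i)
  listSum-map-tabulate f {zero}  g = refl
  listSum-map-tabulate f {suc n} g = cong (f (g zero) +_) (listSum-map-tabulate f (λ i → g (suc i)))

  listSum-map-toList : (f : A → ℕ) {m : ℕ} (xs : Vec A m) → listSum (map f (toList xs)) ≡ ∑[ i < m ] f (lookup xs i)
  listSum-map-toList f Vec.[]       = refl
  listSum-map-toList f (x Vec.∷ xs) = cong (f x +_) (listSum-map-toList f xs)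

  listSum-map-concatMap : ∀ {b} {B : Set b} (f : A → ℕ) (g : B → List A) (ys : List B) →
                          listSum (map f (concatMap g ys)) ≡ listSum (map (λ y → listSum (map f (g y))) ys)
  listSum-map-concatMap f g []       = refl
  listSum-map-concatMap f g (y ∷ ys) = begin
    listSum (map f (g y ++ concatMap g ys))                    ≡⟨ cong listSum (ListProp.map-++ f (g y) (concatMap g ys)) ⟩
    listSum (map f (g y) ++ map f (concatMap g ys))            ≡⟨ ListP.sum-++ (map f (g y)) _ ⟩
    listSum (map f (g y)) + listSum (map f (concatMap g ys))       ≡⟨ cong (listSum (map f (g y)) +_) (listSum-map-concatMap f g ys) ⟩
    listSum (map f (g y)) + listSum (map (λ y → listSum (map f (g y))) ys) ∎
    where open ≡-Reasoning

∑-const : ∀ n k → ∑[ i < n ] k ≡ n * k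
∑-const zero    k = refl
∑-const (suc n) k = cong (k +_) (∑-const n k)

∑-*ˡ : ∀ {n} k (f : Fin n → ℕ) → ∑[ i < n ] (k * f i) ≡ k * ∑[ i < n ] f i
∑-*ˡ {zero}  k f = sym (ℕP.*-zeroʳ k)
∑-*ˡ {suc n} k f = trans (cong (k * f zero +_) (∑-*ˡ k (λ i → f (suc i)))) (sym (ℕP.*-distribˡ-+ k (f zero) _))

∑-point : ∀ {n} (f : Fin n → ℕ) i → (∀ j → j ≢ i → f j ≡ 0) → ∑[ j < n ] f j ≡ f i
∑-point {suc n} f zero    zero-only = begin
  f zero + ∑[ j < n ] f (suc j) ≡⟨ cong (f zero +_) (trans (sum-cong-≗ (λ j → zero-only (suc j) (λ ()))) (trans (∑-const n 0) (ℕP.*-zeroʳ n))) ⟩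
  f zero + 0                    ≡⟨ ℕP.+-identityʳ (f zero) ⟩
  f zero                        ∎
  where open ≡-Reasoning
∑-point {suc n} f (suc i) only = cong₂ _+_ (only zero (λ ()))
  (∑-point (λ j → f (suc j)) i (λ j j≢i → only (suc j) (λ eq → j≢i (FinP.suc-injective eq))))

∑-𝟙-≡ : ∀ {n} (i : Fin n) → ∑[ j < n ] 𝟙 (j FinP.≟ i) ≡ 1
∑-𝟙-≡ i = trans (∑-point _ i (λ j j≢i → 𝟙-no j≢i (j FinP.≟ i))) (𝟙-yes refl (i FinP.≟ i))

∑-≥ : ∀ {n} (f : Fin n → ℕ) i → f i ≤ ∑[ j < n ] f j
∑-≥ f zero    = ℕP.m≤m+n (f zero) _
∑-≥ f (suc i) = ℕP.≤-trans (∑-≥ (λ j → f (suc j)) i) (ℕP.m≤n+m _ (f zero))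

∑-≥-two : ∀ {n} (f : Fin n → ℕ) {i j} → i ≢ j → f i + f j ≤ ∑[ k < n ] f k
∑-≥-two f {zero}  {zero}  i≢j = ⊥-elim (i≢j refl)
∑-≥-two f {zero}  {suc j} _   = ℕP.+-monoʳ-≤ (f zero) (∑-≥ (λ k → f (suc k)) j)
∑-≥-two f {suc i} {zero}  _   = ℕP.≤-trans (ℕP.≤-reflexive (ℕP.+-comm (f (suc i)) (f zero)))
                                           (ℕP.+-monoʳ-≤ (f zero) (∑-≥ (λ k → f (suc k)) i))
∑-≥-two f {suc i} {suc j} i≢j = ℕP.≤-trans (∑-≥-two (λ k → f (suc k)) (λ eq → i≢j (cong suc eq)))
                                           (ℕP.m≤n+m _ (f zero))

∑-mono : ∀ {n} {f g : Fin n → ℕ} → (∀ i → f i ≤ g i) → ∑[ i < n ] f i ≤ ∑[ i < n ] g i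
∑-mono {zero}  f≤g = z≤n
∑-mono {suc n} f≤g = ℕP.+-mono-≤ (f≤g zero) (∑-mono (λ i → f≤g (suc i)))

∑-pos : ∀ {n} (f : Fin n → ℕ) → 0 < ∑[ i < n ] f i → ∃[ i ] 0 < f i
∑-pos {suc n} f pos with f zero in eq
... | suc _ = zero , subst (0 <_) (sym eq) (s≤s z≤n)
... | zero  with ∑-pos (λ i → f (suc i)) pos
...   | i , fi>0 = suc i , fi>0

∑-squeeze : ∀ {n} (f g : Fin n → ℕ) → (∀ i → g i ≤ f i) → ∑[ i < n ] f i ≤ ∑[ i < n ] g i → ∀ i → f i ≡ g i
∑-squeeze {suc n} f g g≤f ∑f≤∑g zero = ℕP.≤-antisym
  (ℕP.+-cancelʳ-≤ _ _ _ (ℕP.≤-trans (ℕP.+-monoʳ-≤ (f zero) (∑-mono (λ i → g≤f (suc i)))) ∑f≤∑g))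
  (g≤f zero)
∑-squeeze {suc n} f g g≤f ∑f≤∑g (suc i) = ∑-squeeze (λ i → f (suc i)) (λ i → g (suc i)) (λ i → g≤f (suc i))
  (ℕP.+-cancelˡ-≤ (g zero) _ _ (ℕP.≤-trans (ℕP.+-monoˡ-≤ _ (g≤f zero)) ∑f≤∑g)) i

𝟙-complement : ∀ {a b} {A : Set a} {B : Set b} → (A ⇔ (¬ B)) → (d : Dec A) (e : Dec B) → 𝟙 d + 𝟙 e ≡ 1
𝟙-complement A⇔¬B (yes x) (yes y) = ⊥-elim (Equivalence.to A⇔¬B x y)
𝟙-complement A⇔¬B (yes _) (no _)  = refl
𝟙-complement A⇔¬B (no _)  (yes _) = refl
𝟙-complement A⇔¬B (no ¬x) (no ¬y) = ⊥-elim (¬x (Equivalence.from A⇔¬B ¬y))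

∑-𝟙-complement : ∀ {n p q} {A : Fin n → Set p} {B : Fin n → Set q} (A? : Decidable A) (B? : Decidable B) →
                 (∀ i → A i ⇔ (¬ B i)) → ∑[ i < n ] 𝟙 (A? i) + ∑[ i < n ] 𝟙 (B? i) ≡ n
∑-𝟙-complement {n} A? B? A⇔¬B = begin
  ∑[ i < n ] 𝟙 (A? i) + ∑[ i < n ] 𝟙 (B? i)  ≡⟨ ∑-distrib-+ (λ i → 𝟙 (A? i)) (λ i → 𝟙 (B? i)) ⟨
  ∑[ i < n ] (𝟙 (A? i) + 𝟙 (B? i))           ≡⟨ sum-cong-≗ (λ i → 𝟙-complement (A⇔¬B i) (A? i) (B? i)) ⟩
  ∑[ i < n ] 1                               ≡⟨ ∑-const n 1 ⟩
  n * 1                                      ≡⟨ ℕP.*-identityʳ n ⟩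
  n                                          ∎
  where open ≡-Reasoning

∑-0 : ∀ {n} {f : Fin n → ℕ} → (∀ i → f i ≡ 0) → ∑[ i < n ] f i ≡ 0
∑-0 {n} f≡0 = trans (sum-cong-≗ f≡0) (trans (∑-const n 0) (ℕP.*-zeroʳ n))

-- Games and schedules

mapGame : ∀ {P Q : Set} → (P → Q) → Game P → Game Q
mapGame f (a , b , c , d) = (f a , f b , f c , f d)

swapSides : ∀ {P : Set} → Game P → Game P
swapSides (a , b , c , d) = (b , a , d , c)

isPair-swap : ∀ {P : Set} {x y a b : P} → IsPair x y (a , b) → IsPair x y (b , a)
isPair-swap = Sum.swap

isPair-sym : ∀ {P : Set} {x y a b : P} → IsPair x y (a , b) → IsPair y x (a , b)
isPair-sym = Sum.swap ∘ Sum.map Prod.swap Prod.swap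

isPair-flip : ∀ {P : Set} {x y a b : P} → IsPair x y (a , b) → IsPair a b (x , y)
isPair-flip = Sum.map (Prod.map sym sym) (Prod.swap ∘ Prod.map sym sym)

isPair-map⁻ : ∀ {P Q : Set} {f : P → Q} → (∀ {s t} → f s ≡ f t → s ≡ t) →
              ∀ {x y a b} → IsPair (f x) (f y) (f a , f b) → IsPair x y (a , b)
isPair-map⁻ f-inj = Sum.map (Prod.map f-inj f-inj) (Prod.map f-inj f-inj)

isPair-map : ∀ {P Q : Set} (f : P → Q) {x y a b} → IsPair x y (a , b) → IsPair (f x) (f y) (f a , f b)
isPair-map f = Sum.map (Prod.map (cong f) (cong f)) (Prod.map (cong f) (cong f))

inGame-map⁻ : ∀ {P Q : Set} {f : P → Q} → (∀ {s t} → f s ≡ f t → s ≡ t) →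
              ∀ {x} G → InGame (f x) (mapGame f G) → InGame x G
inGame-map⁻ f-inj G = Sum.map f-inj (Sum.map f-inj (Sum.map f-inj f-inj))

inGame-map : ∀ {P Q : Set} (f : P → Q) {x} G → InGame x G → InGame (f x) (mapGame f G)
inGame-map f G = Sum.map (cong f) (Sum.map (cong f) (Sum.map (cong f) (cong f)))

inGame-swapSides : ∀ {P : Set} {x : P} G → InGame x (swapSides G) ⇔ InGame x G
inGame-swapSides G = mk⇔ reorder reorder
  where
  reorder : ∀ {A B C D : Set} → A ⊎ B ⊎ C ⊎ D → B ⊎ A ⊎ D ⊎ C
  reorder (inj₁ a)               = inj₂ (inj₁ a)
  reorder (inj₂ (inj₁ b))        = inj₁ b
  reorder (inj₂ (inj₂ (inj₁ c))) = inj₂ (inj₂ (inj₂ c))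
  reorder (inj₂ (inj₂ (inj₂ d))) = inj₂ (inj₂ (inj₁ d))

inGame-partners : ∀ {P : Set} {x a b c d p₁ q₁ p₂ q₂ : P} →
                  IsPair a c (p₁ , q₁) → IsPair b d (p₂ , q₂) →
                  InGame x (a , b , c , d) ⇔ InGame x (p₁ , p₂ , q₁ , q₂)
inGame-partners (inj₁ (refl , refl)) (inj₁ (refl , refl)) = mk⇔ id id
inGame-partners (inj₁ (refl , refl)) (inj₂ (refl , refl)) = mk⇔ flipBD flipBD
  where
  flipBD : ∀ {A B C D : Set} → A ⊎ B ⊎ C ⊎ D → A ⊎ D ⊎ C ⊎ B
  flipBD (inj₁ a)               = inj₁ a
  flipBD (inj₂ (inj₁ b))        = inj₂ (inj₂ (inj₂ b))
  flipBD (inj₂ (inj₂ (inj₁ c))) = inj₂ (inj₂ (inj₁ c))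
  flipBD (inj₂ (inj₂ (inj₂ d))) = inj₂ (inj₁ d)
inGame-partners (inj₂ (refl , refl)) (inj₁ (refl , refl)) = mk⇔ flipAC flipAC
  where
  flipAC : ∀ {A B C D : Set} → A ⊎ B ⊎ C ⊎ D → C ⊎ B ⊎ A ⊎ D
  flipAC (inj₁ a)               = inj₂ (inj₂ (inj₁ a))
  flipAC (inj₂ (inj₁ b))        = inj₂ (inj₁ b)
  flipAC (inj₂ (inj₂ (inj₁ c))) = inj₁ c
  flipAC (inj₂ (inj₂ (inj₂ d))) = inj₂ (inj₂ (inj₂ d))
inGame-partners (inj₂ (refl , refl)) (inj₂ (refl , refl)) = mk⇔ rotate rotate
  where
  rotate : ∀ {A B C D : Set} → A ⊎ B ⊎ C ⊎ D → C ⊎ D ⊎ A ⊎ B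
  rotate (inj₁ a)               = inj₂ (inj₂ (inj₁ a))
  rotate (inj₂ (inj₁ b))        = inj₂ (inj₂ (inj₂ b))
  rotate (inj₂ (inj₂ (inj₁ c))) = inj₁ c
  rotate (inj₂ (inj₂ (inj₂ d))) = inj₂ (inj₁ d)

distinct4-map : ∀ {P Q : Set} {f : P → Q} → (∀ {s t} → f s ≡ f t → s ≡ t) →
                ∀ G → Distinct4 G → Distinct4 (mapGame f G)
distinct4-map f-inj G (ab , ac , ad , bc , bd , cd) =
  ab ∘ f-inj , ac ∘ f-inj , ad ∘ f-inj , bc ∘ f-inj , bd ∘ f-inj , cd ∘ f-inj

seat : ∀ {P : Set} → Game P → Fin 4 → P
seat (a , b , c , d) 0F = a
seat (a , b , c , d) 1F = b
seat (a , b , c , d) 2F = c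
seat (a , b , c , d) 3F = d

inGame⇒seat : ∀ {P : Set} {z : P} G → InGame z G → ∃[ i ] z ≡ seat G i
inGame⇒seat G (inj₁ z≡a)               = 0F , z≡a
inGame⇒seat G (inj₂ (inj₁ z≡b))        = 1F , z≡b
inGame⇒seat G (inj₂ (inj₂ (inj₁ z≡c))) = 2F , z≡c
inGame⇒seat G (inj₂ (inj₂ (inj₂ z≡d))) = 3F , z≡d

seat⇒inGame : ∀ {P : Set} {z : P} G i → z ≡ seat G i → InGame z G
seat⇒inGame G 0F = inj₁
seat⇒inGame G 1F = inj₂ ∘ inj₁
seat⇒inGame G 2F = inj₂ ∘ inj₂ ∘ inj₁
seat⇒inGame G 3F = inj₂ ∘ inj₂ ∘ inj₂

partner⇒inGame : ∀ {P : Set} {x y : P} G → Any (IsPair x y) (partnerPairs G) → InGame x G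
partner⇒inGame G (here (inj₁ (x≡a , _)))         = inj₁ x≡a
partner⇒inGame G (here (inj₂ (x≡c , _)))         = inj₂ (inj₂ (inj₁ x≡c))
partner⇒inGame G (there (here (inj₁ (x≡b , _)))) = inj₂ (inj₁ x≡b)
partner⇒inGame G (there (here (inj₂ (x≡d , _)))) = inj₂ (inj₂ (inj₂ x≡d))

mapGame-cong : ∀ {P Q : Set} {f g : P → Q} → (∀ x → f x ≡ g x) → ∀ G → mapGame f G ≡ mapGame g G
mapGame-cong f≗g (a , b , c , d) = cong₂ _,_ (f≗g a) (cong₂ _,_ (f≗g b) (cong₂ _,_ (f≗g c) (f≗g d)))

distinct4-map⁻ : ∀ {P Q : Set} (f : P → Q) G → Distinct4 (mapGame f G) → Distinct4 G
distinct4-map⁻ f G (ab , ac , ad , bc , bd , cd) =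
  ab ∘ cong f , ac ∘ cong f , ad ∘ cong f , bc ∘ cong f , bd ∘ cong f , cd ∘ cong f

module Seats {P : Set} (_≟_ : DecidableEquality P) where

  seats : P → Game P → ℕ
  seats z G = ∑[ i < 4 ] 𝟙 (z ≟ seat G i)

  inGame⇒seats≥1 : ∀ {z} G → InGame z G → 1 ≤ seats z G
  inGame⇒seats≥1 {z} G z∈G with inGame⇒seat G z∈G
  ... | i , z≡Gi = ℕP.≤-trans (ℕP.≤-reflexive (sym (𝟙-yes z≡Gi (z ≟ seat G i)))) (∑-≥ (λ j → 𝟙 (z ≟ seat G j)) i)

  seats≥1⇒inGame : ∀ {z} G → 1 ≤ seats z G → InGame z G
  seats≥1⇒inGame {z} G seats≥1 with ∑-pos (λ i → 𝟙 (z ≟ seat G i)) seats≥1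
  ... | i , pos = seat⇒inGame G i (𝟙-pos (z ≟ seat G i) pos)

  twice-seats-pos : ∀ {z} G → 0 < 2 * seats z G → InGame z G
  twice-seats-pos {z} G pos = seats≥1⇒inGame G (ℕP.*-cancelˡ-< 2 0 (seats z G) pos)

  𝟙-inGame : ∀ {z} G → seats z G ≤ 1 → 𝟙 (inGame? _≟_ z G) ≡ seats z G
  𝟙-inGame {z} G seats≤1 with inGame? _≟_ z G
  ... | yes z∈G = ℕP.≤-antisym (inGame⇒seats≥1 G z∈G) seats≤1
  ... | no  z∉G = sym (trans (sum-cong-≗ (λ i → 𝟙-no (z∉G ∘ seat⇒inGame G i) (z ≟ seat G i))) (∑-const 4 0))

  seats≤1⇒distinct4 : ∀ G → (∀ z → seats z G ≤ 1) → Distinct4 G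
  seats≤1⇒distinct4 G seats≤1 = apart 0F 1F (λ ()) , apart 0F 2F (λ ()) , apart 0F 3F (λ ()) ,
                                apart 1F 2F (λ ()) , apart 1F 3F (λ ()) , apart 2F 3F (λ ())
    where
    apart : ∀ i j → i ≢ j → seat G i ≢ seat G j
    apart i j i≢j Gi≡Gj = ℕP.<⇒≱ (s≤s (s≤s z≤n)) (ℕP.≤-trans (ℕP.≤-trans
      (ℕP.≤-reflexive (sym (cong₂ _+_ (𝟙-yes refl (seat G i ≟ seat G i)) (𝟙-yes Gi≡Gj (seat G i ≟ seat G j)))))
      (∑-≥-two (λ k → 𝟙 (seat G i ≟ seat G k)) i≢j))
      (seats≤1 (seat G i)))

module Schedules {P : Set} (_≟_ : DecidableEquality P) where

  partnerOcc opponentOcc : P → P → Game P → ℕ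
  partnerOcc  x y g = length (filter (isPair? _≟_ x y) (partnerPairs g))
  opponentOcc x y g = length (filter (isPair? _≟_ x y) (opponentPairs g))

  𝟙-isPair-sym : ∀ x y pr → 𝟙 (isPair? _≟_ x y pr) ≡ 𝟙 (isPair? _≟_ y x pr)
  𝟙-isPair-sym x y pr = 𝟙-cong (mk⇔ isPair-sym isPair-sym) (isPair? _≟_ x y pr) (isPair? _≟_ y x pr)

  module _ {R m} (rounds : Fin R → Vec (Game P) m) where

    partnerCount-sym : ∀ x y → partnerCount _≟_ rounds x y ≡ partnerCount _≟_ rounds y x
    partnerCount-sym x y = cong listSum (ListProp.map-cong
      (λ g → length-filter-cong (isPair? _≟_ x y) (isPair? _≟_ y x) (𝟙-isPair-sym x y) (partnerPairs g))
      (allGames _≟_ rounds))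

    opponentCount-sym : ∀ x y → opponentCount _≟_ rounds x y ≡ opponentCount _≟_ rounds y x
    opponentCount-sym x y = cong listSum (ListProp.map-cong
      (λ g → length-filter-cong (isPair? _≟_ x y) (isPair? _≟_ y x) (𝟙-isPair-sym x y) (opponentPairs g))
      (allGames _≟_ rounds))

    listSum-allGames : (F : Game P → ℕ) → listSum (map F (allGames _≟_ rounds)) ≡ ∑[ r < R ] ∑[ i < m ] F (lookup (rounds r) i)
    listSum-allGames F = begin
      listSum (map F (allGames _≟_ rounds))
        ≡⟨ listSum-map-concatMap F (toList ∘ rounds) (allFin R) ⟩
      listSum (map (λ r → listSum (map F (toList (rounds r)))) (allFin R))
        ≡⟨ listSum-map-tabulate (λ r → listSum (map F (toList (rounds r)))) id ⟩
      ∑[ r < R ] listSum (map F (toList (rounds r)))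
        ≡⟨ sum-cong-≗ (λ r → listSum-map-toList F (rounds r)) ⟩
      ∑[ r < R ] ∑[ i < m ] F (lookup (rounds r) i) ∎
      where open ≡-Reasoning

  module Cyclic {R : ℕ} (act : Fin R → P → P) where

    orbit : P → P → P × P → ℕ
    orbit x y (a , b) = ∑[ r < R ] 𝟙 (isPair? _≟_ x y (act r a , act r b))

    orbit-swap : ∀ x y a b → orbit x y (a , b) ≡ orbit x y (b , a)
    orbit-swap x y a b = sum-cong-≗ λ r →
      𝟙-cong (mk⇔ isPair-swap isPair-swap) (isPair? _≟_ x y (act r a , act r b)) (isPair? _≟_ x y (act r b , act r a))

    partnerOrbit opponentOrbit : P → P → Game P → ℕ
    partnerOrbit  x y g = listSum (map (orbit x y) (partnerPairs g))
    opponentOrbit x y g = listSum (map (orbit x y) (opponentPairs g))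

    ∑-length-filter-shifted : ∀ x y ps →
      ∑[ r < R ] length (filter (isPair? _≟_ x y) (map (Prod.map (act r) (act r)) ps)) ≡ listSum (map (orbit x y) ps)
    ∑-length-filter-shifted x y []             = ∑-0 {R} (λ _ → refl)
    ∑-length-filter-shifted x y ((a , b) ∷ ps) = begin
      ∑[ r < R ] length (filter (isPair? _≟_ x y) (map (Prod.map (act r) (act r)) ((a , b) ∷ ps)))
        ≡⟨ sum-cong-≗ (λ r → length-filter-∷ (isPair? _≟_ x y) (act r a , act r b) _) ⟩
      ∑[ r < R ] (𝟙 (isPair? _≟_ x y (act r a , act r b)) + length (filter (isPair? _≟_ x y) (map (Prod.map (act r) (act r)) ps)))
        ≡⟨ ∑-distrib-+ (λ r → 𝟙 (isPair? _≟_ x y (act r a , act r b)))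
                       (λ r → length (filter (isPair? _≟_ x y) (map (Prod.map (act r) (act r)) ps))) ⟩
      orbit x y (a , b) + ∑[ r < R ] length (filter (isPair? _≟_ x y) (map (Prod.map (act r) (act r)) ps))
        ≡⟨ cong (orbit x y (a , b) +_) (∑-length-filter-shifted x y ps) ⟩
      listSum (map (orbit x y) ((a , b) ∷ ps)) ∎
      where open ≡-Reasoning

    module Translates {m} (I : Vec (Game P) m) (rounds : Fin R → Vec (Game P) m)
                      (lookup-rounds : ∀ r i → lookup (rounds r) i ≡ mapGame (act r) (lookup I i)) where

      private
        ∑-rounds : (F : Game P → ℕ) → listSum (map F (allGames _≟_ rounds)) ≡ ∑[ i < m ] ∑[ r < R ] F (mapGame (act r) (lookup I i))
        ∑-rounds F = begin
          listSum (map F (allGames _≟_ rounds))                 ≡⟨ listSum-allGames rounds F ⟩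
          ∑[ r < R ] ∑[ i < m ] F (lookup (rounds r) i)         ≡⟨ sum-cong-≗ (λ r → sum-cong-≗ (λ i → cong F (lookup-rounds r i))) ⟩
          ∑[ r < R ] ∑[ i < m ] F (mapGame (act r) (lookup I i)) ≡⟨ ∑-comm (λ r i → F (mapGame (act r) (lookup I i))) ⟩
          ∑[ i < m ] ∑[ r < R ] F (mapGame (act r) (lookup I i)) ∎
          where open ≡-Reasoning

      partnerCount-cyclic : ∀ x y → partnerCount _≟_ rounds x y ≡ ∑[ i < m ] partnerOrbit x y (lookup I i)
      partnerCount-cyclic x y = trans (∑-rounds (partnerOcc x y))
        (sum-cong-≗ (λ i → ∑-length-filter-shifted x y (partnerPairs (lookup I i))))

      opponentCount-cyclic : ∀ x y → opponentCount _≟_ rounds x y ≡ ∑[ i < m ] opponentOrbit x y (lookup I i)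
      opponentCount-cyclic x y = trans (∑-rounds (opponentOcc x y))
        (sum-cong-≗ (λ i → ∑-length-filter-shifted x y (opponentPairs (lookup I i))))

      distinct-rounds : (∀ r {x y} → act r x ≡ act r y → x ≡ y) → (∀ i → Distinct4 (lookup I i)) →
                        ∀ r i → Distinct4 (lookup (rounds r) i)
      distinct-rounds act-injective distinct r i = subst Distinct4 (sym (lookup-rounds r i))
        (distinct4-map (act-injective r) (lookup I i) (distinct i))

      gamesOf-cyclic : ∀ x r → gamesOf _≟_ rounds x r ≡ ∑[ i < m ] 𝟙 (inGame? _≟_ x (mapGame (act r) (lookup I i)))
      gamesOf-cyclic x r = trans (length-filter-toList (inGame? _≟_ x) (rounds r))
        (sum-cong-≗ (λ i → cong (𝟙 ∘ inGame? _≟_ x) (lookup-rounds r i)))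

    private
      o₄ : ℕ → ℕ → ℕ → ℕ → ℕ
      o₄ s t u w = s + (t + (u + (w + 0)))

      o₄-swap₁₃ : ∀ s t u w → s + (t + (u + (w + 0))) ≡ u + (t + (s + (w + 0)))
      o₄-swap₁₃ = solve-∀
      o₄-swap₂₄ : ∀ s t u w → s + (t + (u + (w + 0))) ≡ s + (w + (u + (t + 0)))
      o₄-swap₂₄ = solve-∀
      o₄-swap₃₄ : ∀ s t u w → s + (t + (u + (w + 0))) ≡ s + (t + (w + (u + 0)))
      o₄-swap₃₄ = solve-∀
      o₄-reverse : ∀ s t u w → s + (t + (u + (w + 0))) ≡ w + (u + (t + (s + 0)))
      o₄-reverse = solve-∀

    opponentOrbit-swapSides : ∀ x y G → opponentOrbit x y (swapSides G) ≡ opponentOrbit x y G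
    opponentOrbit-swapSides x y (a , b , c , d) =
      trans (cong₂ (λ s t → o₄ s t (o (b , c)) (o (a , d))) (orbit-swap x y b a) (orbit-swap x y d c))
            (o₄-swap₃₄ (o (a , b)) (o (c , d)) (o (b , c)) (o (a , d)))
      where
      o : P × P → ℕ
      o = orbit x y

    opponentOrbit-flipAC : ∀ x y a b c d → opponentOrbit x y (c , b , a , d) ≡ opponentOrbit x y (a , b , c , d)
    opponentOrbit-flipAC x y a b c d =
      trans (cong₂ (λ s w → o₄ s (o (a , d)) (o (c , d)) w) (orbit-swap x y c b) (orbit-swap x y b a))
            (o₄-reverse (o (b , c)) (o (a , d)) (o (c , d)) (o (a , b)))
      where
      o : P × P → ℕ
      o = orbit x y

    opponentOrbit-flipBD : ∀ x y a b c d → opponentOrbit x y (a , d , c , b) ≡ opponentOrbit x y (a , b , c , d)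
    opponentOrbit-flipBD x y a b c d =
      trans (cong₂ (λ t w → o₄ (o (a , d)) t (o (a , b)) w) (orbit-swap x y c b) (orbit-swap x y d c))
            (trans (o₄-swap₁₃ (o (a , d)) (o (b , c)) (o (a , b)) (o (c , d)))
                   (o₄-swap₂₄ (o (a , b)) (o (b , c)) (o (a , d)) (o (c , d))))
      where
      o : P × P → ℕ
      o = orbit x y

    opponentOrbit-partners : ∀ {x y a b c d p₁ q₁ p₂ q₂} → IsPair a c (p₁ , q₁) → IsPair b d (p₂ , q₂) →
                             opponentOrbit x y (a , b , c , d) ≡ opponentOrbit x y (p₁ , p₂ , q₁ , q₂)
    opponentOrbit-partners         (inj₁ (refl , refl)) (inj₁ (refl , refl)) = refl
    opponentOrbit-partners {x} {y} (inj₁ (refl , refl)) (inj₂ (refl , refl)) =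
      sym (opponentOrbit-flipBD x y _ _ _ _)
    opponentOrbit-partners {x} {y} (inj₂ (refl , refl)) (inj₁ (refl , refl)) =
      sym (opponentOrbit-flipAC x y _ _ _ _)
    opponentOrbit-partners {x} {y} (inj₂ (refl , refl)) (inj₂ (refl , refl)) =
      sym (trans (opponentOrbit-flipBD x y _ _ _ _) (opponentOrbit-flipAC x y _ _ _ _))

-- The ring ℤ/v

module Residues (v : ℕ) .{{_ : NonZero v}} where

  open ≡-Reasoning

  infixl 7 _⊗_
  _⊗_ : Fin v → Fin v → Fin v
  x ⊗ y = (toℕ x * toℕ y) mod v

  1ᵥ : Fin v
  1ᵥ = 1 mod v

  toℕ-mod : ∀ a → toℕ (a mod v) ≡ a % v
  toℕ-mod a = FinP.toℕ-fromℕ< (m%n<n a v)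

  mod-toℕ : ∀ x → toℕ x mod v ≡ x
  mod-toℕ x = FinP.toℕ-injective (trans (toℕ-mod (toℕ x)) (m<n⇒m%n≡m (FinP.toℕ<n x)))

  mod-cong : ∀ {a b} → a % v ≡ b % v → a mod v ≡ b mod v
  mod-cong {a} {b} eq = FinP.toℕ-injective (trans (toℕ-mod a) (trans eq (sym (toℕ-mod b))))

  mod-+ : ∀ a b → (a + b) mod v ≡ a mod v ⊕ b mod v
  mod-+ a b = mod-cong (trans (%-distribˡ-+ a b v)
    (sym (cong₂ (λ s t → (s + t) % v) (toℕ-mod a) (toℕ-mod b))))

  mod-* : ∀ a b → (a * b) mod v ≡ (a mod v) ⊗ (b mod v)
  mod-* a b = mod-cong (trans (%-distribˡ-* a b v)
    (sym (cong₂ (λ s t → (s * t) % v) (toℕ-mod a) (toℕ-mod b))))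

  -- Each law is transported from ℕ along the surjective homomorphism _mod v.
  ⊕-assoc : ∀ x y z → (x ⊕ y) ⊕ z ≡ x ⊕ (y ⊕ z)
  ⊕-assoc x y z = begin
    (x ⊕ y) ⊕ z                               ≡⟨ cong ((x ⊕ y) ⊕_) (mod-toℕ z) ⟨
    (toℕ x + toℕ y) mod v ⊕ toℕ z mod v       ≡⟨ mod-+ (toℕ x + toℕ y) (toℕ z) ⟨
    (toℕ x + toℕ y + toℕ z) mod v             ≡⟨ cong (_mod v) (ℕP.+-assoc (toℕ x) (toℕ y) (toℕ z)) ⟩
    (toℕ x + (toℕ y + toℕ z)) mod v           ≡⟨ mod-+ (toℕ x) (toℕ y + toℕ z) ⟩
    toℕ x mod v ⊕ (y ⊕ z)                     ≡⟨ cong (_⊕ (y ⊕ z)) (mod-toℕ x) ⟩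
    x ⊕ (y ⊕ z)                               ∎

  ⊕-comm : ∀ x y → x ⊕ y ≡ y ⊕ x
  ⊕-comm x y = cong (_mod v) (ℕP.+-comm (toℕ x) (toℕ y))

  ⊕-identityˡ : ∀ x → 0ᵥ ⊕ x ≡ x
  ⊕-identityˡ x = begin
    0ᵥ ⊕ x              ≡⟨ cong (0ᵥ ⊕_) (mod-toℕ x) ⟨
    0 mod v ⊕ toℕ x mod v ≡⟨ mod-+ 0 (toℕ x) ⟨
    toℕ x mod v         ≡⟨ mod-toℕ x ⟩
    x                   ∎

  ⊕-identityʳ : ∀ x → x ⊕ 0ᵥ ≡ x
  ⊕-identityʳ x = trans (⊕-comm x 0ᵥ) (⊕-identityˡ x)

  ⊝-inverseʳ : ∀ x → x ⊕ ⊝ x ≡ 0ᵥ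
  ⊝-inverseʳ x = begin
    x ⊕ ⊝ x                        ≡⟨ cong (_⊕ ⊝ x) (mod-toℕ x) ⟨
    toℕ x mod v ⊕ (v ∸ toℕ x) mod v ≡⟨ mod-+ (toℕ x) (v ∸ toℕ x) ⟨
    (toℕ x + (v ∸ toℕ x)) mod v    ≡⟨ cong (_mod v) (ℕP.m+[n∸m]≡n (ℕP.<⇒≤ (FinP.toℕ<n x))) ⟩
    v mod v                        ≡⟨ mod-cong (trans (n%n≡0 v) (sym (m*n%n≡0 0 v))) ⟩
    0ᵥ                             ∎

  ⊝-inverseˡ : ∀ x → ⊝ x ⊕ x ≡ 0ᵥ
  ⊝-inverseˡ x = trans (⊕-comm (⊝ x) x) (⊝-inverseʳ x)

  ⊗-assoc : ∀ x y z → (x ⊗ y) ⊗ z ≡ x ⊗ (y ⊗ z)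
  ⊗-assoc x y z = begin
    (x ⊗ y) ⊗ z                               ≡⟨ cong ((x ⊗ y) ⊗_) (mod-toℕ z) ⟨
    ((toℕ x * toℕ y) mod v) ⊗ (toℕ z mod v)      ≡⟨ mod-* (toℕ x * toℕ y) (toℕ z) ⟨
    (toℕ x * toℕ y * toℕ z) mod v             ≡⟨ cong (_mod v) (ℕP.*-assoc (toℕ x) (toℕ y) (toℕ z)) ⟩
    (toℕ x * (toℕ y * toℕ z)) mod v           ≡⟨ mod-* (toℕ x) (toℕ y * toℕ z) ⟩
    (toℕ x mod v) ⊗ (y ⊗ z)                 ≡⟨ cong (_⊗ (y ⊗ z)) (mod-toℕ x) ⟩
    x ⊗ (y ⊗ z)                               ∎

  ⊗-comm : ∀ x y → x ⊗ y ≡ y ⊗ x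
  ⊗-comm x y = cong (_mod v) (ℕP.*-comm (toℕ x) (toℕ y))

  ⊗-identityˡ : ∀ x → 1ᵥ ⊗ x ≡ x
  ⊗-identityˡ x = begin
    1ᵥ ⊗ x                ≡⟨ cong (1ᵥ ⊗_) (mod-toℕ x) ⟨
    (1 mod v) ⊗ (toℕ x mod v) ≡⟨ mod-* 1 (toℕ x) ⟨
    (1 * toℕ x) mod v     ≡⟨ cong (_mod v) (ℕP.*-identityˡ (toℕ x)) ⟩
    toℕ x mod v           ≡⟨ mod-toℕ x ⟩
    x                     ∎

  ⊗-identityʳ : ∀ x → x ⊗ 1ᵥ ≡ x
  ⊗-identityʳ x = trans (⊗-comm x 1ᵥ) (⊗-identityˡ x)

  ⊗-distribˡ-⊕ : ∀ x y z → x ⊗ (y ⊕ z) ≡ x ⊗ y ⊕ x ⊗ z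
  ⊗-distribˡ-⊕ x y z = begin
    x ⊗ (y ⊕ z)                               ≡⟨ cong (_⊗ (y ⊕ z)) (mod-toℕ x) ⟨
    (toℕ x mod v) ⊗ ((toℕ y + toℕ z) mod v)      ≡⟨ mod-* (toℕ x) (toℕ y + toℕ z) ⟨
    (toℕ x * (toℕ y + toℕ z)) mod v           ≡⟨ cong (_mod v) (ℕP.*-distribˡ-+ (toℕ x) (toℕ y) (toℕ z)) ⟩
    (toℕ x * toℕ y + toℕ x * toℕ z) mod v     ≡⟨ mod-+ (toℕ x * toℕ y) (toℕ x * toℕ z) ⟩
    x ⊗ y ⊕ x ⊗ z                             ∎

  ⊗-distribʳ-⊕ : ∀ x y z → (y ⊕ z) ⊗ x ≡ y ⊗ x ⊕ z ⊗ x
  ⊗-distribʳ-⊕ x y z = begin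
    (y ⊕ z) ⊗ x       ≡⟨ ⊗-comm (y ⊕ z) x ⟩
    x ⊗ (y ⊕ z)       ≡⟨ ⊗-distribˡ-⊕ x y z ⟩
    x ⊗ y ⊕ x ⊗ z     ≡⟨ cong₂ _⊕_ (⊗-comm x y) (⊗-comm x z) ⟩
    y ⊗ x ⊕ z ⊗ x     ∎

  ℤ/v-isCommutativeRing : IsCommutativeRing _≡_ _⊕_ _⊗_ ⊝_ 0ᵥ 1ᵥ
  ℤ/v-isCommutativeRing = record
    { isRing = record
      { +-isAbelianGroup = record
        { isGroup = record
          { isMonoid = record
            { isSemigroup = record
              { isMagma = record { isEquivalence = isEquivalence ; ∙-cong = cong₂ _⊕_ }
              ; assoc = ⊕-assoc }
            ; identity = ⊕-identityˡ , ⊕-identityʳ }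
          ; inverse = ⊝-inverseˡ , ⊝-inverseʳ
          ; ⁻¹-cong = cong ⊝_ }
        ; comm = ⊕-comm }
      ; *-cong = cong₂ _⊗_
      ; *-assoc = ⊗-assoc
      ; *-identity = ⊗-identityˡ , ⊗-identityʳ
      ; distrib = ⊗-distribˡ-⊕ , ⊗-distribʳ-⊕ }
    ; *-comm = ⊗-comm }

  ℤ/v : CommutativeRing _ _
  ℤ/v = record { isCommutativeRing = ℤ/v-isCommutativeRing }

  open import Algebra.Properties.Ring (CommutativeRing.ring ℤ/v)
    using (-‿distribˡ-*; -‿distribʳ-*; -‿involutive)
  open import Algebra.Properties.AbelianGroup (CommutativeRing.+-abelianGroup ℤ/v)
    using (⁻¹-anti-homo‿-; ⁻¹-∙-comm; ε⁻¹≈ε)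

  ⊝-involutive : ∀ x → ⊝ (⊝ x) ≡ x
  ⊝-involutive = -‿involutive

  ⊝0ᵥ : ⊝ 0ᵥ ≡ 0ᵥ
  ⊝0ᵥ = ε⁻¹≈ε

  ⊖-cancelʳ : ∀ {x y z} → x ≡ y ⊕ z → x ⊖ z ≡ y
  ⊖-cancelʳ {x} {y} {z} refl = begin
    (y ⊕ z) ⊕ ⊝ z   ≡⟨ ⊕-assoc y z (⊝ z) ⟩
    y ⊕ (z ⊕ ⊝ z)   ≡⟨ cong (y ⊕_) (⊝-inverseʳ z) ⟩
    y ⊕ 0ᵥ          ≡⟨ ⊕-identityʳ y ⟩
    y               ∎

  -- The ring solver normalises with integer coefficients, interpreted in ℤ/v by fromℤ.
  fromℤ : ℤ → Fin v
  fromℤ (ℤ.+ n)    = n mod v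
  fromℤ ℤ.-[1+ n ] = ⊝ (suc n mod v)

  fromℤ-neg : ∀ i → fromℤ (ℤ.- i) ≡ ⊝ fromℤ i
  fromℤ-neg (ℤ.+ zero)  = sym ⊝0ᵥ
  fromℤ-neg ℤ.+[1+ n ]  = refl
  fromℤ-neg ℤ.-[1+ n ]  = sym (⊝-involutive _)

  fromℤ-⊖ : ∀ m n → fromℤ (m ℤ.⊖ n) ≡ m mod v ⊖ n mod v
  fromℤ-⊖ m n with n ℕP.≤? m
  ... | yes n≤m = begin
    fromℤ (m ℤ.⊖ n)       ≡⟨ cong fromℤ (ℤP.⊖-≥ n≤m) ⟩
    (m ∸ n) mod v         ≡⟨ ⊖-cancelʳ {m mod v} {(m ∸ n) mod v} {n mod v} (trans (cong (_mod v) (sym (ℕP.m∸n+n≡m n≤m))) (mod-+ (m ∸ n) n)) ⟨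
    m mod v ⊖ n mod v     ∎
  ... | no n≰m = begin
    fromℤ (m ℤ.⊖ n)              ≡⟨ cong fromℤ (ℤP.⊖-< m<n) ⟩
    fromℤ (ℤ.- (ℤ.+ (n ∸ m)))    ≡⟨ fromℤ-neg (ℤ.+ (n ∸ m)) ⟩
    ⊝ ((n ∸ m) mod v)            ≡⟨ cong ⊝_ (⊖-cancelʳ {n mod v} {(n ∸ m) mod v} {m mod v}
                                      (trans (cong (_mod v) (sym (ℕP.m∸n+n≡m (ℕP.<⇒≤ m<n)))) (mod-+ (n ∸ m) m))) ⟨
    ⊝ (n mod v ⊖ m mod v)        ≡⟨ ⁻¹-anti-homo‿- (n mod v) (m mod v) ⟩
    m mod v ⊖ n mod v            ∎
    where
    m<n : m < n
    m<n = ℕP.≰⇒> n≰m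

  fromℤ-+ : ∀ i j → fromℤ (i ℤ.+ j) ≡ fromℤ i ⊕ fromℤ j
  fromℤ-+ (ℤ.+ m)    (ℤ.+ n)    = mod-+ m n
  fromℤ-+ (ℤ.+ m)    ℤ.-[1+ n ] = fromℤ-⊖ m (suc n)
  fromℤ-+ ℤ.-[1+ m ] (ℤ.+ n)    = trans (fromℤ-⊖ n (suc m)) (⊕-comm (n mod v) (⊝ (suc m mod v)))
  fromℤ-+ ℤ.-[1+ m ] ℤ.-[1+ n ] = begin
    ⊝ (suc (suc (m + n)) mod v)            ≡⟨ cong (λ k → ⊝ (suc k mod v)) (ℕP.+-suc m n) ⟨
    ⊝ ((suc m + suc n) mod v)              ≡⟨ cong ⊝_ (mod-+ (suc m) (suc n)) ⟩
    ⊝ (suc m mod v ⊕ suc n mod v)          ≡⟨ ⁻¹-∙-comm (suc m mod v) (suc n mod v) ⟨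
    ⊝ (suc m mod v) ⊕ ⊝ (suc n mod v)      ∎

  fromℤ-*⁺ : ∀ m j → fromℤ (ℤ.+ m ℤ.* j) ≡ (m mod v) ⊗ fromℤ j
  fromℤ-*⁺ m (ℤ.+ n)    = trans (cong fromℤ (sym (ℤP.pos-* m n))) (mod-* m n)
  fromℤ-*⁺ m ℤ.-[1+ n ] = begin
    fromℤ (ℤ.+ m ℤ.* ℤ.-[1+ n ])          ≡⟨ cong fromℤ (ℤP.neg-distribʳ-* (ℤ.+ m) (ℤ.+ suc n)) ⟨
    fromℤ (ℤ.- (ℤ.+ m ℤ.* ℤ.+ suc n))     ≡⟨ fromℤ-neg (ℤ.+ m ℤ.* ℤ.+ suc n) ⟩
    ⊝ fromℤ (ℤ.+ m ℤ.* ℤ.+ suc n)         ≡⟨ cong ⊝_ (fromℤ-*⁺ m (ℤ.+ suc n)) ⟩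
    ⊝ ((m mod v) ⊗ (suc n mod v))         ≡⟨ -‿distribʳ-* (m mod v) (suc n mod v) ⟩
    (m mod v) ⊗ ⊝ (suc n mod v)           ∎

  fromℤ-* : ∀ i j → fromℤ (i ℤ.* j) ≡ fromℤ i ⊗ fromℤ j
  fromℤ-* (ℤ.+ m)    j = fromℤ-*⁺ m j
  fromℤ-* ℤ.-[1+ m ] j = begin
    fromℤ (ℤ.-[1+ m ] ℤ.* j)          ≡⟨ cong fromℤ (ℤP.neg-distribˡ-* (ℤ.+ suc m) j) ⟨
    fromℤ (ℤ.- (ℤ.+ suc m ℤ.* j))     ≡⟨ fromℤ-neg (ℤ.+ suc m ℤ.* j) ⟩
    ⊝ fromℤ (ℤ.+ suc m ℤ.* j)         ≡⟨ cong ⊝_ (fromℤ-*⁺ (suc m) j) ⟩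
    ⊝ ((suc m mod v) ⊗ fromℤ j)       ≡⟨ -‿distribˡ-* (suc m mod v) (fromℤ j) ⟩
    ⊝ (suc m mod v) ⊗ fromℤ j         ∎

  private
    ℤ/v-almost : AlmostCommutativeRing _ _
    ℤ/v-almost = fromCommutativeRing ℤ/v

    fromℤ-morphism : ℤ.+-*-rawRing -Raw-AlmostCommutative⟶ ℤ/v-almost
    fromℤ-morphism = record
      { ⟦_⟧ = fromℤ ; +-homo = fromℤ-+ ; *-homo = fromℤ-* ; -‿homo = fromℤ-neg
      ; 0-homo = refl ; 1-homo = refl }

    fromℤ-≟ : ∀ i j → Maybe (fromℤ i ≡ fromℤ j)
    fromℤ-≟ i j with i ℤ.≟ j
    ... | yes i≡j = just (cong fromℤ i≡j)
    ... | no _    = nothing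

  open Algebra.Solver.Ring ℤ.+-*-rawRing ℤ/v-almost fromℤ-morphism fromℤ-≟ public
    using (solve; _:+_; _:-_; :-_; _:*_; _:=_)

  ⊕-cancelʳ : ∀ {a b} r → a ⊕ r ≡ b ⊕ r → a ≡ b
  ⊕-cancelʳ {a} {b} r eq = trans (sym (⊖-cancelʳ {a ⊕ r} {a} {r} refl)) (⊖-cancelʳ {a ⊕ r} {b} {r} eq)

  ≡⊕⇔⊖≡ : ∀ {z a r} → z ≡ a ⊕ r ⇔ z ⊖ r ≡ a
  ≡⊕⇔⊖≡ {z} {a} {r} = mk⇔ (⊖-cancelʳ {z} {a} {r})
    (λ z⊖r≡a → trans (solve 2 (λ z r → z := (z :- r) :+ r) refl z r) (cong (_⊕ r) z⊖r≡a))

  ⊕-⊖-shift : ∀ x y z → x ⊕ (y ⊖ z) ≡ (x ⊖ z) ⊕ y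
  ⊕-⊖-shift x y z = begin
    x ⊕ (y ⊕ ⊝ z)     ≡⟨ cong (x ⊕_) (⊕-comm y (⊝ z)) ⟩
    x ⊕ (⊝ z ⊕ y)     ≡⟨ ⊕-assoc x (⊝ z) y ⟨
    (x ⊕ ⊝ z) ⊕ y     ∎

  ⊖≡0⇒≡ : ∀ {a b} → a ⊖ b ≡ 0ᵥ → a ≡ b
  ⊖≡0⇒≡ {a} {b} eq = begin
    a                ≡⟨ solve 2 (λ a b → a := (a :- b) :+ b) refl a b ⟩
    (a ⊖ b) ⊕ b      ≡⟨ cong (_⊕ b) eq ⟩
    0ᵥ ⊕ b           ≡⟨ ⊕-identityˡ b ⟩
    b                ∎

  ⊕≡0⇒≡⊝ : ∀ {a b} → a ⊕ b ≡ 0ᵥ → a ≡ ⊝ b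
  ⊕≡0⇒≡⊝ {a} {b} eq = begin
    a              ≡⟨ ⊖-cancelʳ {a ⊕ b} {a} {b} refl ⟨
    (a ⊕ b) ⊖ b    ≡⟨ cong (_⊖ b) eq ⟩
    0ᵥ ⊕ ⊝ b       ≡⟨ ⊕-identityˡ (⊝ b) ⟩
    ⊝ b            ∎

  ⊝-injective : ∀ {a b} → ⊝ a ≡ ⊝ b → a ≡ b
  ⊝-injective {a} {b} eq = trans (sym (⊝-involutive a)) (trans (cong ⊝_ eq) (⊝-involutive b))

  halving-unit : ∀ n → v ≡ suc (2 * n) → (suc n mod v) ⊕ (suc n mod v) ≡ 1ᵥ
  halving-unit n v≡2n+1 = begin
    suc n mod v ⊕ suc n mod v   ≡⟨ mod-+ (suc n) (suc n) ⟨
    (suc n + suc n) mod v       ≡⟨ cong (_mod v) (double-suc n) ⟩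
    (1 + suc (2 * n)) mod v     ≡⟨ cong (λ u → (1 + u) mod v) v≡2n+1 ⟨
    (1 + v) mod v               ≡⟨ mod-cong ([m+n]%n≡m%n 1 v) ⟩
    1ᵥ                          ∎
    where
    double-suc : ∀ n → suc n + suc n ≡ 1 + suc (2 * n)
    double-suc = solve-∀

  module Halving (c : Fin v) (c⊕c≡1 : c ⊕ c ≡ 1ᵥ) where

    half : Fin v → Fin v
    half d = d ⊗ c

    half-double : ∀ d → half d ⊕ half d ≡ d
    half-double d = begin
      d ⊗ c ⊕ d ⊗ c    ≡⟨ ⊗-distribˡ-⊕ d c c ⟨
      d ⊗ (c ⊕ c)      ≡⟨ cong (d ⊗_) c⊕c≡1 ⟩
      d ⊗ 1ᵥ           ≡⟨ ⊗-identityʳ d ⟩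
      d                ∎

    double-injective : ∀ {x y} → x ⊕ x ≡ y ⊕ y → x ≡ y
    double-injective {x} {y} eq = trans (sym (half-of-double x)) (trans (cong half eq) (half-of-double y))
      where
      half-of-double : ∀ x → half (x ⊕ x) ≡ x
      half-of-double x = begin
        (x ⊕ x) ⊗ c        ≡⟨ solve 2 (λ x c → (x :+ x) :* c := x :* (c :+ c)) refl x c ⟩
        x ⊗ (c ⊕ c)        ≡⟨ cong (x ⊗_) c⊕c≡1 ⟩
        x ⊗ 1ᵥ             ≡⟨ ⊗-identityʳ x ⟩
        x                  ∎

    half≡⇔ : ∀ {d t} → d ≡ t ⊕ t ⇔ half d ≡ t
    half≡⇔ {d} {t} = mk⇔ (λ d≡2t → double-injective (trans (half-double d) d≡2t))
                         (λ half≡t → trans (sym (half-double d)) (cong₂ _⊕_ half≡t half≡t))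

    half≢0 : ∀ {d} → d ≢ 0ᵥ → half d ≢ 0ᵥ
    half≢0 {d} d≢0 half≡0 = d≢0 (trans (Equivalence.from half≡⇔ half≡0) (⊕-identityˡ 0ᵥ))

    ≡⊝⇒≡0 : ∀ {x} → x ≡ ⊝ x → x ≡ 0ᵥ
    ≡⊝⇒≡0 {x} x≡⊝x = double-injective (trans (cong (x ⊕_) x≡⊝x) (trans (⊝-inverseʳ x) (sym (⊕-identityˡ 0ᵥ))))

-- Cyclic schedules over ℤ/v

module Cyclic-ℤ (v : ℕ) .{{_ : NonZero v}} where

  open Residues v public
  open Seats (FinP._≟_ {v}) public
  open Schedules (FinP._≟_ {v}) public
  open Cyclic (λ (r x : Fin v) → x ⊕ r) public

  infix 4 _≟_
  _≟_ : DecidableEquality (Fin v)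
  _≟_ = FinP._≟_

  module Translates-ℤ {m} (I : Vec (Game (Fin v)) m) = Translates I (roundsZ I) (λ r i → VecP.lookup-map i (translate r) I)

  game± : Fin v × Fin v → Game (Fin v)
  game± (x , y) = (x , y , ⊝ x , ⊝ y)

  orbit-ordered : ∀ p q a b → ∑[ r < v ] 𝟙 ((p ≟ a ⊕ r) ×-dec (q ≟ b ⊕ r)) ≡ 𝟙 (q ⊖ p ≟ b ⊖ a)
  orbit-ordered p q a b = begin
    ∑[ r < v ] 𝟙 (meets r)   ≡⟨ ∑-point (λ r → 𝟙 (meets r)) (p ⊖ a) misses ⟩
    𝟙 (meets (p ⊖ a))        ≡⟨ 𝟙-cong meets⇔ (meets (p ⊖ a)) (q ⊖ p ≟ b ⊖ a) ⟩
    𝟙 (q ⊖ p ≟ b ⊖ a)        ∎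
    where
    open ≡-Reasoning
    meets : ∀ r → Dec (p ≡ a ⊕ r × q ≡ b ⊕ r)
    meets r = (p ≟ a ⊕ r) ×-dec (q ≟ b ⊕ r)
    misses : ∀ r → r ≢ p ⊖ a → 𝟙 (meets r) ≡ 0
    misses r r≢p-a = 𝟙-no (λ (p≡a+r , _) → r≢p-a (sym (⊖-cancelʳ (trans p≡a+r (⊕-comm a r))))) (meets r)
    meets⇔ : (p ≡ a ⊕ (p ⊖ a) × q ≡ b ⊕ (p ⊖ a)) ⇔ q ⊖ p ≡ b ⊖ a
    meets⇔ = mk⇔
      (λ (_ , q≡) → Equivalence.to (≡⊕⇔⊖≡ {q} {b ⊖ a} {p}) (trans q≡ (⊕-⊖-shift b p a)))
      (λ q⊖p≡b⊖a → trans (Equivalence.from (≡⊕⇔⊖≡ {p} {p ⊖ a} {a}) refl) (⊕-comm (p ⊖ a) a) ,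
                   trans (Equivalence.from (≡⊕⇔⊖≡ {q} {b ⊖ a} {p}) q⊖p≡b⊖a) (sym (⊕-⊖-shift b p a)))

  orbit-pair : ∀ {p q} → p ≢ q → ∀ a b → orbit p q (a , b) ≡ 𝟙 (q ⊖ p ≟ b ⊖ a) + 𝟙 (q ⊖ p ≟ a ⊖ b)
  orbit-pair {p} {q} p≢q a b = begin
    ∑[ r < v ] 𝟙 (isPair? _≟_ p q (a ⊕ r , b ⊕ r))
      ≡⟨ sum-cong-≗ (λ r → 𝟙-⊎ (λ ((p≡ , _) , (_ , q≡)) → p≢q (trans p≡ (sym q≡)))
                               ((p ≟ a ⊕ r) ×-dec (q ≟ b ⊕ r)) ((p ≟ b ⊕ r) ×-dec (q ≟ a ⊕ r))) ⟩
    ∑[ r < v ] (𝟙 ((p ≟ a ⊕ r) ×-dec (q ≟ b ⊕ r)) + 𝟙 ((p ≟ b ⊕ r) ×-dec (q ≟ a ⊕ r)))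
      ≡⟨ ∑-distrib-+ (λ r → 𝟙 ((p ≟ a ⊕ r) ×-dec (q ≟ b ⊕ r))) (λ r → 𝟙 ((p ≟ b ⊕ r) ×-dec (q ≟ a ⊕ r))) ⟩
    ∑[ r < v ] 𝟙 ((p ≟ a ⊕ r) ×-dec (q ≟ b ⊕ r)) + ∑[ r < v ] 𝟙 ((p ≟ b ⊕ r) ×-dec (q ≟ a ⊕ r))
      ≡⟨ cong₂ _+_ (orbit-ordered p q a b) (orbit-ordered p q b a) ⟩
    𝟙 (q ⊖ p ≟ b ⊖ a) + 𝟙 (q ⊖ p ≟ a ⊖ b) ∎
    where open ≡-Reasoning

  orbit-pair′ : ∀ {p q} → p ≢ q → ∀ a b {s t} → b ⊖ a ≡ s → a ⊖ b ≡ t → orbit p q (a , b) ≡ 𝟙 (q ⊖ p ≟ s) + 𝟙 (q ⊖ p ≟ t)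
  orbit-pair′ p≢q a b refl refl = orbit-pair p≢q a b

  opponentOrbit-game± : ∀ {p q} → p ≢ q → ∀ x y →
                        opponentOrbit p q (game± (x , y)) ≡ 2 * seats (q ⊖ p) (game± (diffSum (x , y)))
  opponentOrbit-game± {p} {q} p≢q x y = begin
    o (x , y) + (o (⊝ x , ⊝ y) + (o (x , ⊝ y) + (o (y , ⊝ x) + 0)))
      ≡⟨ cong₂ _+_ (orbit-pair′ p≢q x y (solve 2 (λ x y → y :- x := :- (x :- y)) refl x y) refl)
        (cong₂ _+_ (orbit-pair′ p≢q (⊝ x) (⊝ y) (solve 2 (λ x y → (:- y) :- (:- x) := x :- y) refl x y)
                                    (solve 2 (λ x y → (:- x) :- (:- y) := :- (x :- y)) refl x y))
        (cong₂ _+_ (orbit-pair′ p≢q x (⊝ y) (solve 2 (λ x y → (:- y) :- x := :- (x :+ y)) refl x y)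
                                    (solve 2 (λ x y → x :- (:- y) := x :+ y) refl x y))
        (cong (_+ 0) (orbit-pair′ p≢q y (⊝ x) (solve 2 (λ x y → (:- x) :- y := :- (x :+ y)) refl x y)
                                      (solve 2 (λ x y → y :- (:- x) := x :+ y) refl x y))))) ⟩
    (C + A) + ((A + C) + ((D + B) + ((D + B) + 0)))
      ≡⟨ collect A B C D ⟩
    2 * (A + (B + (C + (D + 0)))) ∎
    where
    open ≡-Reasoning
    o : Fin v × Fin v → ℕ
    o = orbit p q
    d : Fin v
    d = q ⊖ p
    A B C D : ℕ
    A = 𝟙 (d ≟ x ⊖ y)
    B = 𝟙 (d ≟ x ⊕ y)
    C = 𝟙 (d ≟ ⊝ (x ⊖ y))
    D = 𝟙 (d ≟ ⊝ (x ⊕ y))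
    collect : ∀ A B C D → (C + A) + ((A + C) + ((D + B) + ((D + B) + 0))) ≡ 2 * (A + (B + (C + (D + 0))))
    collect = solve-∀

  module _ (c : Fin v) (c⊕c≡1 : c ⊕ c ≡ 1ᵥ) where
    open Halving c c⊕c≡1

    orbit-±pair : ∀ {p q} → p ≢ q → ∀ x → orbit p q (x , ⊝ x) ≡ 𝟙 (half (q ⊖ p) ≟ ⊝ x) + 𝟙 (half (q ⊖ p) ≟ x)
    orbit-±pair {p} {q} p≢q x = begin
      orbit p q (x , ⊝ x)                           ≡⟨ orbit-pair′ p≢q x (⊝ x) (solve 1 (λ x → (:- x) :- x := (:- x) :+ (:- x)) refl x)
                                                                     (solve 1 (λ x → x :- (:- x) := x :+ x) refl x) ⟩
      𝟙 (d ≟ ⊝ x ⊕ ⊝ x) + 𝟙 (d ≟ x ⊕ x)             ≡⟨ cong₂ _+_ (𝟙-cong half≡⇔ (d ≟ ⊝ x ⊕ ⊝ x) (half d ≟ ⊝ x))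
                                                                 (𝟙-cong half≡⇔ (d ≟ x ⊕ x) (half d ≟ x)) ⟩
      𝟙 (half d ≟ ⊝ x) + 𝟙 (half d ≟ x)             ∎
      where
      open ≡-Reasoning
      d : Fin v
      d = q ⊖ p

    partnerOrbit-game± : ∀ {p q} → p ≢ q → ∀ x y →
                         partnerOrbit p q (game± (x , y)) ≡ seats (half (q ⊖ p)) (game± (x , y))
    partnerOrbit-game± {p} {q} p≢q x y =
      trans (cong₂ _+_ (orbit-±pair p≢q x) (cong (_+ 0) (orbit-±pair p≢q y)))
            (collect (𝟙 (h ≟ ⊝ x)) (𝟙 (h ≟ x)) (𝟙 (h ≟ ⊝ y)) (𝟙 (h ≟ y)))
      where
      h : Fin v
      h = half (q ⊖ p)
      collect : ∀ A B C D → (A + B) + ((C + D) + 0) ≡ B + (D + (A + (C + 0)))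
      collect = solve-∀

  inGame-translate : ∀ z r G → InGame z (mapGame (_⊕ r) G) ⇔ InGame (z ⊖ r) G
  inGame-translate z r G = mk⇔ (Sum.map to (Sum.map to (Sum.map to to))) (Sum.map from (Sum.map from (Sum.map from from)))
    where
    to : ∀ {a} → z ≡ a ⊕ r → z ⊖ r ≡ a
    to = Equivalence.to ≡⊕⇔⊖≡
    from : ∀ {a} → z ⊖ r ≡ a → z ≡ a ⊕ r
    from = Equivalence.from ≡⊕⇔⊖≡

  ∑-seats : ∀ G → ∑[ z < v ] seats z G ≡ 4
  ∑-seats G = trans (∑-comm (λ z i → 𝟙 (z ≟ seat G i))) (sum-cong-≗ (λ i → ∑-𝟙-≡ (seat G i)))

  -- The m games offer 4m seats in all, so a covering of a set of size 4m by them is exact.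
  module Covering {m} (w : Fin m → Fin v × Fin v) {A : Fin v → Set} (A? : Decidable A)
                  (covers : ∀ z → A z → ∃[ i ] z ∈± w i)
                  (|A|≡4m : ∑[ z < v ] 𝟙 (A? z) ≡ 4 * m) where

    multiplicity : ∀ z → ∑[ i < m ] seats z (game± (w i)) ≡ 𝟙 (A? z)
    multiplicity = ∑-squeeze (λ z → ∑[ i < m ] seats z (game± (w i))) (λ z → 𝟙 (A? z)) covered total≤
      where
      covered : ∀ z → 𝟙 (A? z) ≤ ∑[ i < m ] seats z (game± (w i))
      covered z with A? z
      ... | no _  = z≤n
      ... | yes z∈A with covers z z∈A
      ...   | i , z∈±wi = ℕP.≤-trans (inGame⇒seats≥1 (game± (w i)) z∈±wi) (∑-≥ (λ j → seats z (game± (w j))) i)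
      total≤ : ∑[ z < v ] ∑[ i < m ] seats z (game± (w i)) ≤ ∑[ z < v ] 𝟙 (A? z)
      total≤ = ℕP.≤-reflexive (begin
        ∑[ z < v ] ∑[ i < m ] seats z (game± (w i)) ≡⟨ ∑-comm (λ z i → seats z (game± (w i))) ⟩
        ∑[ i < m ] ∑[ z < v ] seats z (game± (w i)) ≡⟨ sum-cong-≗ (λ i → ∑-seats (game± (w i))) ⟩
        ∑[ i < m ] 4                                ≡⟨ ∑-const m 4 ⟩
        m * 4                                       ≡⟨ ℕP.*-comm m 4 ⟩
        4 * m                                       ≡⟨ |A|≡4m ⟨
        ∑[ z < v ] 𝟙 (A? z)                         ∎)
        where open ≡-Reasoning

    seats≤1 : ∀ z i → seats z (game± (w i)) ≤ 1
    seats≤1 z i = ℕP.≤-trans (∑-≥ (λ j → seats z (game± (w j))) i)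
                             (ℕP.≤-trans (ℕP.≤-reflexive (multiplicity z)) (𝟙≤1 (A? z)))

    covered⇒A : ∀ z i → z ∈± w i → A z
    covered⇒A z i z∈±wi = 𝟙-pos (A? z) (ℕP.≤-trans (inGame⇒seats≥1 (game± (w i)) z∈±wi)
      (ℕP.≤-trans (∑-≥ (λ j → seats z (game± (w j))) i) (ℕP.≤-reflexive (multiplicity z))))

    distinct : ∀ i → Distinct4 (game± (w i))
    distinct i = seats≤1⇒distinct4 (game± (w i)) (λ z → seats≤1 z i)

  isPair-±⇒≡⊝ : ∀ {a c x} → IsPair a c (x , ⊝ x) → c ≡ ⊝ a
  isPair-±⇒≡⊝ (inj₁ (refl , refl)) = refl
  isPair-±⇒≡⊝ (inj₂ (refl , refl)) = sym (⊝-involutive _)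

  module _ {Q : Set} (f : Fin v → Q) where

    isPair-±-flip : ∀ {X Y z x} → IsPair X Y (f z , f (⊝ z)) → z ≡ ⊝ x → IsPair X Y (f x , f (⊝ x))
    isPair-±-flip {X} {Y} {x = x} X,Y refl =
      subst (λ t → IsPair X Y (f t , f (⊝ x))) (⊝-involutive x) (isPair-swap X,Y)

    ±pair⇒partner : ∀ {X Y z} w → IsPair X Y (f z , f (⊝ z)) → z ∈± w → Any (IsPair X Y) (partnerPairs (mapGame f (game± w)))
    ±pair⇒partner w X,Y (inj₁ refl)               = here X,Y
    ±pair⇒partner w X,Y (inj₂ (inj₁ refl))        = there (here X,Y)
    ±pair⇒partner w X,Y (inj₂ (inj₂ (inj₁ z≡⊝x))) = here (isPair-±-flip X,Y z≡⊝x)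
    ±pair⇒partner w X,Y (inj₂ (inj₂ (inj₂ z≡⊝y))) = there (here (isPair-±-flip X,Y z≡⊝y))

  0∉±diffSum : ∀ {x y} → Distinct4 (game± (x , y)) → ¬ 0ᵥ ∈± diffSum (x , y)
  0∉±diffSum (x≢y , _ , x≢⊝y , _) (inj₁ 0≡x-y)               = x≢y (⊖≡0⇒≡ (sym 0≡x-y))
  0∉±diffSum (x≢y , _ , x≢⊝y , _) (inj₂ (inj₁ 0≡x+y))        = x≢⊝y (⊕≡0⇒≡⊝ (sym 0≡x+y))
  0∉±diffSum (x≢y , _ , x≢⊝y , _) (inj₂ (inj₂ (inj₁ 0≡-d)))  = x≢y (⊖≡0⇒≡ (⊝-injective (trans (sym 0≡-d) (sym ⊝0ᵥ))))
  0∉±diffSum (x≢y , _ , x≢⊝y , _) (inj₂ (inj₂ (inj₂ 0≡-s)))  = x≢⊝y (⊕≡0⇒≡⊝ (⊝-injective (trans (sym 0≡-s) (sym ⊝0ᵥ))))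

  ⊖0ᵥ : ∀ z → z ⊖ 0ᵥ ≡ z
  ⊖0ᵥ z = trans (cong (z ⊕_) ⊝0ᵥ) (⊕-identityʳ z)

  opponentOrbit-from-0 : ∀ {z} → 0ᵥ ≢ z → ∀ w → opponentOrbit 0ᵥ z (game± w) ≡ 2 * seats z (game± (diffSum w))
  opponentOrbit-from-0 {z} 0≢z (x , y) =
    trans (opponentOrbit-game± 0≢z x y) (cong (λ t → 2 * seats t (game± (diffSum (x , y)))) (⊖0ᵥ z))

  ∑-𝟙-≡⊕ : ∀ q b → ∑[ r < v ] 𝟙 (q ≟ b ⊕ r) ≡ 1
  ∑-𝟙-≡⊕ q b = trans
    (∑-point _ (q ⊖ b) λ r r≢ → 𝟙-no (λ q≡ → r≢ (sym (⊖-cancelʳ (trans q≡ (⊕-comm b r))))) (q ≟ b ⊕ r))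
    (𝟙-yes (solve 2 (λ b q → q := b :+ (q :- b)) refl b q) (q ≟ b ⊕ (q ⊖ b)))

  𝟙-inGame-translate : ∀ z r G → seats (z ⊖ r) G ≤ 1 → 𝟙 (inGame? _≟_ z (mapGame (_⊕ r) G)) ≡ seats (z ⊖ r) G
  𝟙-inGame-translate z r G seats≤1 =
    trans (𝟙-cong (inGame-translate z r G) (inGame? _≟_ z (mapGame (_⊕ r) G)) (inGame? _≟_ (z ⊖ r) G)) (𝟙-inGame G seats≤1)

-- v = 4m + 1

module Residues-4m+1 (m : ℕ) where

  open Cyclic-ℤ (suc (4 * m)) public

  ½ : Fin (suc (4 * m))
  ½ = suc (2 * m) mod suc (4 * m)

  ½⊕½≡1 : ½ ⊕ ½ ≡ 1ᵥ
  ½⊕½≡1 = halving-unit (2 * m) (cong suc (ℕP.*-assoc 2 2 m))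

  open Halving ½ ½⊕½≡1 public

  nonzero? : (z : Fin (suc (4 * m))) → Dec (z ≢ 0ᵥ)
  nonzero? z = ¬? (z ≟ 0ᵥ)

  ∑-nonzero : ∑[ z < suc (4 * m) ] 𝟙 (nonzero? z) ≡ 4 * m
  ∑-nonzero = ℕP.suc-injective (begin
    suc (∑[ z < suc (4 * m) ] 𝟙 (nonzero? z))                            ≡⟨ ℕP.+-comm 1 _ ⟩
    ∑[ z < suc (4 * m) ] 𝟙 (nonzero? z) + 1                              ≡⟨ cong (∑[ z < suc (4 * m) ] 𝟙 (nonzero? z) +_) (∑-𝟙-≡ {suc (4 * m)} 0ᵥ) ⟨
    ∑[ z < suc (4 * m) ] 𝟙 (nonzero? z) + ∑[ z < suc (4 * m) ] 𝟙 (z ≟ 0ᵥ) ≡⟨ ∑-𝟙-complement nonzero? (_≟ 0ᵥ) (λ _ → mk⇔ id id) ⟩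
    suc (4 * m)                                                          ∎)
    where open ≡-Reasoning

  PartnerPair : Fin (suc (4 * m)) → Fin (suc (4 * m)) → Set
  PartnerPair p q = ∃[ x ] (x ≢ 0ᵥ × IsPair p q (x , ⊝ x))

  ⊖≢0 : ∀ {p q} → p ≢ q → q ⊖ p ≢ 0ᵥ
  ⊖≢0 p≢q q⊖p≡0 = p≢q (sym (⊖≡0⇒≡ q⊖p≡0))

module PS⇒ZCPS (m : ℕ) (S : Vec (Fin (suc (4 * m)) × Fin (suc (4 * m))) m) (isPS : IsPS m S) where

  open Residues-4m+1 m

  I : Vec (Game (Fin (suc (4 * m)))) m
  I = Vec.map game± S

  lookup-I : ∀ i → lookup I i ≡ game± (lookup S i)
  lookup-I i = VecP.lookup-map i game± S

  open Translates-ℤ I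

  module S±  = Covering (lookup S) nonzero? (λ z → Equivalence.from (proj₁ isPS z)) ∑-nonzero
  module S±ᵈ = Covering (diffSum ∘ lookup S) nonzero? (λ z → Equivalence.from (proj₂ isPS z)) ∑-nonzero

  distinct : ∀ r i → Distinct4 (lookup (roundsZ I r) i)
  distinct = distinct-rounds (λ r → ⊕-cancelʳ r) (λ i → subst Distinct4 (sym (lookup-I i)) (S±.distinct i))

  partners-once : ∀ p q → p ≢ q → partnerCount _≟_ (roundsZ I) p q ≡ 1
  partners-once p q p≢q = begin
    partnerCount _≟_ (roundsZ I) p q                     ≡⟨ partnerCount-cyclic p q ⟩
    ∑[ i < m ] partnerOrbit p q (lookup I i)             ≡⟨ sum-cong-≗ (λ i → cong (partnerOrbit p q) (lookup-I i)) ⟩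
    ∑[ i < m ] partnerOrbit p q (game± (lookup S i))     ≡⟨ sum-cong-≗ (λ i → partnerOrbit-game± ½ ½⊕½≡1 p≢q (proj₁ (lookup S i)) (proj₂ (lookup S i))) ⟩
    ∑[ i < m ] seats (half (q ⊖ p)) (game± (lookup S i)) ≡⟨ S±.multiplicity (half (q ⊖ p)) ⟩
    𝟙 (nonzero? (half (q ⊖ p)))                          ≡⟨ 𝟙-yes (half≢0 (⊖≢0 p≢q)) (nonzero? (half (q ⊖ p))) ⟩
    1                                                    ∎
    where open ≡-Reasoning

  opponents-twice : ∀ p q → p ≢ q → opponentCount _≟_ (roundsZ I) p q ≡ 2
  opponents-twice p q p≢q = begin
    opponentCount _≟_ (roundsZ I) p q                                ≡⟨ opponentCount-cyclic p q ⟩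
    ∑[ i < m ] opponentOrbit p q (lookup I i)                        ≡⟨ sum-cong-≗ (λ i → cong (opponentOrbit p q) (lookup-I i)) ⟩
    ∑[ i < m ] opponentOrbit p q (game± (lookup S i))                ≡⟨ sum-cong-≗ (λ i → opponentOrbit-game± p≢q (proj₁ (lookup S i)) (proj₂ (lookup S i))) ⟩
    ∑[ i < m ] (2 * seats (q ⊖ p) (game± (diffSum (lookup S i))))    ≡⟨ ∑-*ˡ 2 (λ i → seats (q ⊖ p) (game± (diffSum (lookup S i)))) ⟩
    2 * ∑[ i < m ] seats (q ⊖ p) (game± (diffSum (lookup S i)))      ≡⟨ cong (2 *_) (S±ᵈ.multiplicity (q ⊖ p)) ⟩
    2 * 𝟙 (nonzero? (q ⊖ p))                                         ≡⟨ cong (2 *_) (𝟙-yes (⊖≢0 p≢q) (nonzero? (q ⊖ p))) ⟩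
    2                                                                ∎
    where open ≡-Reasoning

  gamesOf-I : ∀ x r → gamesOf _≟_ (roundsZ I) x r ≡ 𝟙 (nonzero? (x ⊖ r))
  gamesOf-I x r = begin
    gamesOf _≟_ (roundsZ I) x r                                               ≡⟨ gamesOf-cyclic x r ⟩
    ∑[ i < m ] 𝟙 (inGame? _≟_ x (mapGame (_⊕ r) (lookup I i)))               ≡⟨ sum-cong-≗ (λ i → cong (𝟙 ∘ inGame? _≟_ x ∘ mapGame (_⊕ r)) (lookup-I i)) ⟩
    ∑[ i < m ] 𝟙 (inGame? _≟_ x (mapGame (_⊕ r) (game± (lookup S i))))       ≡⟨ sum-cong-≗ (λ i → 𝟙-inGame-translate x r (game± (lookup S i)) (S±.seats≤1 (x ⊖ r) i)) ⟩
    ∑[ i < m ] seats (x ⊖ r) (game± (lookup S i))                             ≡⟨ S±.multiplicity (x ⊖ r) ⟩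
    𝟙 (nonzero? (x ⊖ r))                                                      ∎
    where open ≡-Reasoning

  sits-out-once : ∀ x → ∃[ r₀ ] (gamesOf _≟_ (roundsZ I) x r₀ ≡ 0 × (∀ r → r ≢ r₀ → gamesOf _≟_ (roundsZ I) x r ≡ 1))
  sits-out-once x = x , trans (gamesOf-I x x) (𝟙-no (λ x⊖x≢0 → x⊖x≢0 (⊝-inverseʳ x)) (nonzero? (x ⊖ x))) ,
                    λ r r≢x → trans (gamesOf-I x r) (𝟙-yes (λ x⊖r≡0 → r≢x (sym (⊖≡0⇒≡ x⊖r≡0))) (nonzero? (x ⊖ r)))

  0∉I : ∀ i → ¬ InGame 0ᵥ (lookup I i)
  0∉I i 0∈Ii = S±.covered⇒A 0ᵥ i (subst (InGame 0ᵥ) (lookup-I i) 0∈Ii) refl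

  initial-partners : ∀ p q → IsInitialPartnerPair I p q ⇔ PartnerPair p q
  initial-partners p q = mk⇔ to from
    where
    to : IsInitialPartnerPair I p q → PartnerPair p q
    to (i , p,q∈Ii) with subst (Any (IsPair p q) ∘ partnerPairs) (lookup-I i) p,q∈Ii
    ... | here p,q≡x         = proj₁ (lookup S i) , S±.covered⇒A _ i (inj₁ refl) , p,q≡x
    ... | there (here p,q≡y) = proj₂ (lookup S i) , S±.covered⇒A _ i (inj₂ (inj₁ refl)) , p,q≡y
    from : PartnerPair p q → IsInitialPartnerPair I p q
    from (z , z≢0 , p,q≡z) with Equivalence.from (proj₁ isPS z) z≢0
    ... | i , z∈±Si = i , subst (Any (IsPair p q) ∘ partnerPairs) (sym (lookup-I i)) (±pair⇒partner id (lookup S i) p,q≡z z∈±Si)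

  zcps : IsZCPSWh-4m+1 m I
  zcps = ((((distinct , partners-once , opponents-twice) , sits-out-once) , 0∉I) , initial-partners)

module ZCPS⇒PS (m : ℕ) (I : Vec (Game (Fin (suc (4 * m)))) m) (zcps : IsZCPSWh-4m+1 m I) where

  open Residues-4m+1 m

  private
    distinct-round : ∀ r i → Distinct4 (lookup (roundsZ I r) i)
    distinct-round = proj₁ (proj₁ (proj₁ (proj₁ zcps)))
    opponents-twice : ∀ p q → p ≢ q → opponentCount _≟_ (roundsZ I) p q ≡ 2
    opponents-twice = proj₂ (proj₂ (proj₁ (proj₁ (proj₁ zcps))))
    0∉I : ∀ i → ¬ InGame 0ᵥ (lookup I i)
    0∉I = proj₂ (proj₁ zcps)
    initial-partners : ∀ p q → IsInitialPartnerPair I p q ⇔ PartnerPair p q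
    initial-partners = proj₂ zcps

  open Translates-ℤ I

  base : Fin m → Fin (suc (4 * m)) × Fin (suc (4 * m))
  base i = proj₁ (lookup I i) , proj₁ (proj₂ (lookup I i))

  -- Both partner pairs of an initial game have the form {x, -x}.
  lookup-I : ∀ i → lookup I i ≡ game± (base i)
  lookup-I i = cong₂ (λ c d → (proj₁ (base i) , proj₂ (base i) , c , d))
    (isPair-±⇒≡⊝ (proj₂ (proj₂ (Equivalence.to (initial-partners _ _) (i , here (inj₁ (refl , refl)))))))
    (isPair-±⇒≡⊝ (proj₂ (proj₂ (Equivalence.to (initial-partners _ _) (i , there (here (inj₁ (refl , refl))))))))

  distinct : ∀ i → Distinct4 (game± (base i))
  distinct i = subst Distinct4 (trans (VecP.lookup-map i (translate 0ᵥ) I) (trans (mapGame-cong ⊕-identityʳ (lookup I i)) (lookup-I i)))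
                     (distinct-round 0ᵥ i)

  S : Vec (Fin (suc (4 * m)) × Fin (suc (4 * m))) m
  S = Vec.tabulate base

  lookup-S : ∀ i → lookup S i ≡ base i
  lookup-S = VecP.lookup∘tabulate base

  ±-cover : ∀ z → (∃[ i ] z ∈± lookup S i) ⇔ z ≢ 0ᵥ
  ±-cover z = mk⇔ to from
    where
    to : ∃[ i ] z ∈± lookup S i → z ≢ 0ᵥ
    to (i , z∈±Si) refl = 0∉I i (subst (InGame 0ᵥ) (sym (lookup-I i)) (subst (0ᵥ ∈±_) (lookup-S i) z∈±Si))
    from : z ≢ 0ᵥ → ∃[ i ] z ∈± lookup S i
    from z≢0 with Equivalence.from (initial-partners z (⊝ z)) (z , z≢0 , inj₁ (refl , refl))
    ... | i , z,⊝z∈Ii = i , subst (z ∈±_) (sym (lookup-S i)) (subst (InGame z) (lookup-I i) (partner⇒inGame (lookup I i) z,⊝z∈Ii))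

  diff-cover : ∀ z → (∃[ i ] z ∈± diffSum (lookup S i)) ⇔ z ≢ 0ᵥ
  diff-cover z = mk⇔ to from
    where
    to : ∃[ i ] z ∈± diffSum (lookup S i) → z ≢ 0ᵥ
    to (i , z∈±) refl = 0∉±diffSum (distinct i) (subst (λ s → 0ᵥ ∈± diffSum s) (lookup-S i) z∈±)
    from : z ≢ 0ᵥ → ∃[ i ] z ∈± diffSum (lookup S i)
    from z≢0 =
      let i , pos = ∑-pos (λ i → opponentOrbit 0ᵥ z (lookup I i))
                          (subst (0 <_) (trans (sym (opponents-twice 0ᵥ z (z≢0 ∘ sym))) (opponentCount-cyclic 0ᵥ z)) (s≤s z≤n))
      in i , subst (λ s → z ∈± diffSum s) (sym (lookup-S i))
                   (twice-seats-pos (game± (diffSum (base i)))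
                     (subst (0 <_) (trans (cong (opponentOrbit 0ᵥ z) (lookup-I i)) (opponentOrbit-from-0 (z≢0 ∘ sym) (base i))) pos))

  ps : IsPS m S
  ps = ±-cover , diff-cover

-- v = 4k + 3

module Residues-4k+3 (k : ℕ) where

  open Cyclic-ℤ (suc (4 * k + 2)) public

  ½ : Fin (suc (4 * k + 2))
  ½ = suc (2 * k + 1) mod suc (4 * k + 2)

  ½⊕½≡1 : ½ ⊕ ½ ≡ 1ᵥ
  ½⊕½≡1 = halving-unit (2 * k + 1) (cong suc (4k+2≡2[2k+1] k))
    where
    4k+2≡2[2k+1] : ∀ k → 4 * k + 2 ≡ 2 * (2 * k + 1)
    4k+2≡2[2k+1] = solve-∀

  open Halving ½ ½⊕½≡1 public

  Player : Set
  Player = Maybe (Fin (suc (4 * k + 2)))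

  PartnerPair : Player → Player → Set
  PartnerPair X Y = (∃[ x ] (x ≢ 0ᵥ × IsPair X Y (just x , just (⊝ x)))) ⊎ IsPair X Y (nothing , just 0ᵥ)

  _≟∞_ : DecidableEquality Player
  _≟∞_ = MaybeP.≡-dec _≟_

  -- The translation by r of a player, extracted from translate∞ (which defines it locally).
  shift∞ : Fin (suc (4 * k + 2)) → Player → Player
  shift∞ r X = proj₁ (translate∞ r (X , X , X , X))

  shift∞-injective : ∀ r {X Y} → shift∞ r X ≡ shift∞ r Y → X ≡ Y
  shift∞-injective r {nothing} {nothing} _  = refl
  shift∞-injective r {just x}  {just y}  eq = cong just (⊕-cancelʳ r (MaybeP.just-injective eq))

  shift∞-0 : ∀ X → shift∞ 0ᵥ X ≡ X
  shift∞-0 nothing  = refl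
  shift∞-0 (just x) = cong just (⊕-identityʳ x)

  module ∞ where
    open Seats _≟∞_ public
    open Schedules _≟∞_ public hiding (module Cyclic)
    open Schedules.Cyclic _≟∞_ shift∞ public

  module Translates-∞ {m} (I : Vec (Game Player) m) =
    ∞.Translates I (roundsZ∞ I) (λ r i → VecP.lookup-map i (translate∞ r) I)

  orbit-just : ∀ p q a b → ∞.orbit (just p) (just q) (just a , just b) ≡ orbit p q (a , b)
  orbit-just p q a b = sum-cong-≗ λ r →
    𝟙-cong (mk⇔ (isPair-map⁻ MaybeP.just-injective) (isPair-map just))
           (isPair? _≟∞_ (just p) (just q) (just (a ⊕ r) , just (b ⊕ r))) (isPair? _≟_ p q (a ⊕ r , b ⊕ r))

  partnerOrbit-just : ∀ p q G → ∞.partnerOrbit (just p) (just q) (mapGame just G) ≡ partnerOrbit p q G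
  partnerOrbit-just p q (a , b , c , d) = cong₂ _+_ (orbit-just p q a c) (cong (_+ 0) (orbit-just p q b d))

  opponentOrbit-just : ∀ p q G → ∞.opponentOrbit (just p) (just q) (mapGame just G) ≡ opponentOrbit p q G
  opponentOrbit-just p q (a , b , c , d) = cong₂ _+_ (orbit-just p q a b) (cong₂ _+_ (orbit-just p q c d)
    (cong₂ _+_ (orbit-just p q a d) (cong (_+ 0) (orbit-just p q b c))))

  orbit-just-∞ : ∀ p q B → ∞.orbit (just p) (just q) (nothing , B) ≡ 0
  orbit-just-∞ p q B = ∑-0 λ r →
    𝟙-no (λ { (inj₁ (() , _)) ; (inj₂ (_ , ())) }) (isPair? _≟∞_ (just p) (just q) (nothing , shift∞ r B))

  orbit-∞-∞ : ∀ q b → ∞.orbit nothing (just q) (nothing , just b) ≡ 1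
  orbit-∞-∞ q b = trans (sum-cong-≗ λ r → 𝟙-cong (mk⇔ to (λ q≡ → inj₁ (refl , cong just q≡)))
                                              (isPair? _≟∞_ nothing (just q) (nothing , just (b ⊕ r))) (q ≟ b ⊕ r))
                      (∑-𝟙-≡⊕ q b)
    where
    to : ∀ {x} → IsPair nothing (just q) (nothing , just x) → q ≡ x
    to (inj₁ (_ , q≡x)) = MaybeP.just-injective q≡x

  orbit-∞-just : ∀ q a b → ∞.orbit nothing (just q) (just a , just b) ≡ 0
  orbit-∞-just q a b = ∑-0 λ r →
    𝟙-no (λ { (inj₁ (() , _)) ; (inj₂ (() , _)) }) (isPair? _≟∞_ nothing (just q) (just (a ⊕ r) , just (b ⊕ r)))

  partnerOrbit-∞-just : ∀ q G → ∞.partnerOrbit nothing (just q) (mapGame just G) ≡ 0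
  partnerOrbit-∞-just q (a , b , c , d) = cong₂ _+_ (orbit-∞-just q a c) (cong (_+ 0) (orbit-∞-just q b d))

  opponentOrbit-∞-just : ∀ q G → ∞.opponentOrbit nothing (just q) (mapGame just G) ≡ 0
  opponentOrbit-∞-just q (a , b , c , d) = cong₂ _+_ (orbit-∞-just q a b) (cong₂ _+_ (orbit-∞-just q c d)
    (cong₂ _+_ (orbit-∞-just q a d) (cong (_+ 0) (orbit-∞-just q b c))))

  game∞ : Fin (suc (4 * k + 2)) → Game Player
  game∞ α = (nothing , just α , just 0ᵥ , just (⊝ α))

  partnerOrbit-game∞ : ∀ {p q} → p ≢ q → ∀ α →
                       ∞.partnerOrbit (just p) (just q) (game∞ α) ≡ 𝟙 (half (q ⊖ p) ≟ ⊝ α) + 𝟙 (half (q ⊖ p) ≟ α)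
  partnerOrbit-game∞ {p} {q} p≢q α = begin
    ∞.orbit (just p) (just q) (nothing , just 0ᵥ) + (∞.orbit (just p) (just q) (just α , just (⊝ α)) + 0)
      ≡⟨ cong₂ _+_ (orbit-just-∞ p q (just 0ᵥ)) (ℕP.+-identityʳ _) ⟩
    ∞.orbit (just p) (just q) (just α , just (⊝ α))
      ≡⟨ orbit-just p q α (⊝ α) ⟩
    orbit p q (α , ⊝ α)
      ≡⟨ orbit-±pair ½ ½⊕½≡1 p≢q α ⟩
    𝟙 (half (q ⊖ p) ≟ ⊝ α) + 𝟙 (half (q ⊖ p) ≟ α) ∎
    where open ≡-Reasoning

  opponentOrbit-game∞ : ∀ {p q} → p ≢ q → ∀ α →
                        ∞.opponentOrbit (just p) (just q) (game∞ α) ≡ 2 * (𝟙 (q ⊖ p ≟ α) + 𝟙 (q ⊖ p ≟ ⊝ α))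
  opponentOrbit-game∞ {p} {q} p≢q α = begin
    o (nothing , just α) + (o (just 0ᵥ , just (⊝ α)) + (o (nothing , just (⊝ α)) + (o (just α , just 0ᵥ) + 0)))
      ≡⟨ cong₂ _+_ (orbit-just-∞ p q (just α))
        (cong₂ _+_ (trans (orbit-just p q 0ᵥ (⊝ α)) (orbit-pair′ p≢q 0ᵥ (⊝ α) (⊖0ᵥ (⊝ α)) 0⊖⊝α))
        (cong₂ _+_ (orbit-just-∞ p q (just (⊝ α)))
        (cong (_+ 0) (trans (orbit-just p q α 0ᵥ) (orbit-pair′ p≢q α 0ᵥ (⊕-identityˡ (⊝ α)) (⊖0ᵥ α)))))) ⟩
    0 + ((B + A) + (0 + ((B + A) + 0)))
      ≡⟨ collect A B ⟩
    2 * (A + B) ∎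
    where
    open ≡-Reasoning
    o : Player × Player → ℕ
    o = ∞.orbit (just p) (just q)
    A B : ℕ
    A = 𝟙 (q ⊖ p ≟ α)
    B = 𝟙 (q ⊖ p ≟ ⊝ α)
    0⊖⊝α : 0ᵥ ⊖ ⊝ α ≡ α
    0⊖⊝α = trans (⊕-identityˡ (⊝ (⊝ α))) (⊝-involutive α)
    collect : ∀ A B → 0 + ((B + A) + (0 + ((B + A) + 0))) ≡ 2 * (A + B)
    collect = solve-∀

  partnerOrbit-∞-game∞ : ∀ q α → ∞.partnerOrbit nothing (just q) (game∞ α) ≡ 1
  partnerOrbit-∞-game∞ q α = cong₂ _+_ (orbit-∞-∞ q 0ᵥ) (cong (_+ 0) (orbit-∞-just q α (⊝ α)))

  opponentOrbit-∞-game∞ : ∀ q α → ∞.opponentOrbit nothing (just q) (game∞ α) ≡ 2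
  opponentOrbit-∞-game∞ q α = cong₂ _+_ (orbit-∞-∞ q α) (cong₂ _+_ (orbit-∞-just q 0ᵥ (⊝ α))
    (cong₂ _+_ (orbit-∞-∞ q (⊝ α)) (cong (_+ 0) (orbit-∞-just q α 0ᵥ))))

  module Exceptional (α : Fin (suc (4 * k + 2))) (α≢0 : α ≢ 0ᵥ) where

    ⊝α≢0 : ⊝ α ≢ 0ᵥ
    ⊝α≢0 ⊝α≡0 = α≢0 (⊝-injective (trans ⊝α≡0 (sym ⊝0ᵥ)))

    α≢⊝α : α ≢ ⊝ α
    α≢⊝α = α≢0 ∘ ≡⊝⇒≡0

    exceptional? : ∀ z → Dec (z ≡ 0ᵥ ⊎ z ≡ α ⊎ z ≡ ⊝ α)
    exceptional? z = (z ≟ 0ᵥ) ⊎-dec ((z ≟ α) ⊎-dec (z ≟ ⊝ α))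

    ordinary? : ∀ z → Dec (z ≢ 0ᵥ × z ≢ α × z ≢ ⊝ α)
    ordinary? z = ¬? (z ≟ 0ᵥ) ×-dec (¬? (z ≟ α) ×-dec ¬? (z ≟ ⊝ α))

    ordinary⇔¬exceptional : ∀ z → (z ≢ 0ᵥ × z ≢ α × z ≢ ⊝ α) ⇔ (¬ (z ≡ 0ᵥ ⊎ z ≡ α ⊎ z ≡ ⊝ α))
    ordinary⇔¬exceptional z = mk⇔
      (λ { (z≢0 , z≢α , z≢⊝α) (inj₁ z≡0) → z≢0 z≡0 ; (z≢0 , z≢α , z≢⊝α) (inj₂ (inj₁ z≡α)) → z≢α z≡α
         ; (z≢0 , z≢α , z≢⊝α) (inj₂ (inj₂ z≡⊝α)) → z≢⊝α z≡⊝α })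
      (λ ¬exc → ¬exc ∘ inj₁ , ¬exc ∘ inj₂ ∘ inj₁ , ¬exc ∘ inj₂ ∘ inj₂)

    𝟙-exceptional : ∀ z → 𝟙 (exceptional? z) ≡ 𝟙 (z ≟ 0ᵥ) + (𝟙 (z ≟ α) + 𝟙 (z ≟ ⊝ α))
    𝟙-exceptional z = trans
      (𝟙-⊎ (λ { (z≡0 , inj₁ z≡α) → α≢0 (trans (sym z≡α) z≡0) ; (z≡0 , inj₂ z≡⊝α) → ⊝α≢0 (trans (sym z≡⊝α) z≡0) })
           (z ≟ 0ᵥ) ((z ≟ α) ⊎-dec (z ≟ ⊝ α)))
      (cong (𝟙 (z ≟ 0ᵥ) +_) (𝟙-⊎ (λ (z≡α , z≡⊝α) → α≢⊝α (trans (sym z≡α) z≡⊝α)) (z ≟ α) (z ≟ ⊝ α)))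

    ∑-ordinary : ∑[ z < suc (4 * k + 2) ] 𝟙 (ordinary? z) ≡ 4 * k
    ∑-ordinary = ℕP.+-cancelʳ-≡ 3 _ _ (begin
      ∑[ z < suc (4 * k + 2) ] 𝟙 (ordinary? z) + 3
        ≡⟨ cong (∑[ z < suc (4 * k + 2) ] 𝟙 (ordinary? z) +_) (sym ∑-exceptional) ⟩
      ∑[ z < suc (4 * k + 2) ] 𝟙 (ordinary? z) + ∑[ z < suc (4 * k + 2) ] 𝟙 (exceptional? z)
        ≡⟨ ∑-𝟙-complement ordinary? exceptional? ordinary⇔¬exceptional ⟩
      suc (4 * k + 2)
        ≡⟨ ℕP.+-suc (4 * k) 2 ⟨
      4 * k + 3 ∎)
      where
      open ≡-Reasoning
      ∑-exceptional : ∑[ z < suc (4 * k + 2) ] 𝟙 (exceptional? z) ≡ 3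
      ∑-exceptional = begin
        ∑[ z < suc (4 * k + 2) ] 𝟙 (exceptional? z)
          ≡⟨ sum-cong-≗ 𝟙-exceptional ⟩
        ∑[ z < suc (4 * k + 2) ] (𝟙 (z ≟ 0ᵥ) + (𝟙 (z ≟ α) + 𝟙 (z ≟ ⊝ α)))
          ≡⟨ ∑-distrib-+ (λ z → 𝟙 (z ≟ 0ᵥ)) (λ z → 𝟙 (z ≟ α) + 𝟙 (z ≟ ⊝ α)) ⟩
        ∑[ z < suc (4 * k + 2) ] 𝟙 (z ≟ 0ᵥ) + ∑[ z < suc (4 * k + 2) ] (𝟙 (z ≟ α) + 𝟙 (z ≟ ⊝ α))
          ≡⟨ cong₂ _+_ (∑-𝟙-≡ {suc (4 * k + 2)} 0ᵥ)
                       (trans (∑-distrib-+ (λ z → 𝟙 (z ≟ α)) (λ z → 𝟙 (z ≟ ⊝ α))) (cong₂ _+_ (∑-𝟙-≡ α) (∑-𝟙-≡ (⊝ α)))) ⟩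
        3 ∎

    nonzero-partition : ∀ {z} → z ≢ 0ᵥ → 𝟙 (z ≟ α) + 𝟙 (z ≟ ⊝ α) + 𝟙 (ordinary? z) ≡ 1
    nonzero-partition {z} z≢0 = begin
      𝟙 (z ≟ α) + 𝟙 (z ≟ ⊝ α) + 𝟙 (ordinary? z)                    ≡⟨ cong (λ n → n + (𝟙 (z ≟ α) + 𝟙 (z ≟ ⊝ α)) + 𝟙 (ordinary? z)) (𝟙-no z≢0 (z ≟ 0ᵥ)) ⟨
      𝟙 (z ≟ 0ᵥ) + (𝟙 (z ≟ α) + 𝟙 (z ≟ ⊝ α)) + 𝟙 (ordinary? z)     ≡⟨ cong (_+ 𝟙 (ordinary? z)) (𝟙-exceptional z) ⟨
      𝟙 (exceptional? z) + 𝟙 (ordinary? z)                          ≡⟨ ℕP.+-comm (𝟙 (exceptional? z)) _ ⟩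
      𝟙 (ordinary? z) + 𝟙 (exceptional? z)                          ≡⟨ 𝟙-complement (ordinary⇔¬exceptional z) (ordinary? z) (exceptional? z) ⟩
      1                                                             ∎
      where open ≡-Reasoning

module APS⇒ZCPS (k : ℕ) (α : Fin (suc (4 * k + 2))) (α≢0 : α ≢ 0ᵥ)
                (S : Vec (Fin (suc (4 * k + 2)) × Fin (suc (4 * k + 2))) k) (isAPS : IsAPS k α α S) where

  open Residues-4k+3 k
  open Exceptional α α≢0

  I : Vec (Game Player) (suc k)
  I = game∞ α Vec.∷ Vec.map (mapGame just ∘ game±) S

  lookup-I : ∀ i → lookup I (suc i) ≡ mapGame just (game± (lookup S i))
  lookup-I i = VecP.lookup-map i (mapGame just ∘ game±) S

  open Translates-∞ I

  module S±  = Covering (lookup S) ordinary? (λ z → Equivalence.from (proj₁ isAPS z)) ∑-ordinary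
  module S±ᵈ = Covering (diffSum ∘ lookup S) ordinary? (λ z → Equivalence.from (proj₂ isAPS z)) ∑-ordinary

  distinct : ∀ r i → Distinct4 (lookup (roundsZ∞ I r) i)
  distinct = distinct-rounds shift∞-injective distinct-I
    where
    distinct-I : ∀ i → Distinct4 (lookup I i)
    distinct-I zero    = (λ ()) , (λ ()) , (λ ()) , α≢0 ∘ MaybeP.just-injective ,
                         α≢⊝α ∘ MaybeP.just-injective , (⊝α≢0 ∘ sym) ∘ MaybeP.just-injective
    distinct-I (suc i) = subst Distinct4 (sym (lookup-I i)) (distinct4-map MaybeP.just-injective _ (S±.distinct i))

  partners-once : ∀ X Y → X ≢ Y → partnerCount _≟∞_ (roundsZ∞ I) X Y ≡ 1
  partners-once nothing  nothing  X≢Y = ⊥-elim (X≢Y refl)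
  partners-once (just p) (just q) X≢Y = begin
    partnerCount _≟∞_ (roundsZ∞ I) (just p) (just q)
      ≡⟨ partnerCount-cyclic (just p) (just q) ⟩
    ∞.partnerOrbit (just p) (just q) (game∞ α) + ∑[ i < k ] ∞.partnerOrbit (just p) (just q) (lookup I (suc i))
      ≡⟨ cong₂ _+_ (partnerOrbit-game∞ p≢q α) (sum-cong-≗ λ i → begin
           ∞.partnerOrbit (just p) (just q) (lookup I (suc i))               ≡⟨ cong (∞.partnerOrbit (just p) (just q)) (lookup-I i) ⟩
           ∞.partnerOrbit (just p) (just q) (mapGame just (game± (lookup S i))) ≡⟨ partnerOrbit-just p q (game± (lookup S i)) ⟩
           partnerOrbit p q (game± (lookup S i))                             ≡⟨ partnerOrbit-game± ½ ½⊕½≡1 p≢q (proj₁ (lookup S i)) (proj₂ (lookup S i)) ⟩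
           seats h (game± (lookup S i))                                      ∎) ⟩
    𝟙 (h ≟ ⊝ α) + 𝟙 (h ≟ α) + ∑[ i < k ] seats h (game± (lookup S i))
      ≡⟨ cong₂ _+_ (ℕP.+-comm (𝟙 (h ≟ ⊝ α)) _) (S±.multiplicity h) ⟩
    𝟙 (h ≟ α) + 𝟙 (h ≟ ⊝ α) + 𝟙 (ordinary? h)
      ≡⟨ nonzero-partition (half≢0 (λ q⊖p≡0 → p≢q (sym (⊖≡0⇒≡ q⊖p≡0)))) ⟩
    1 ∎
    where
    open ≡-Reasoning
    p≢q : p ≢ q
    p≢q = X≢Y ∘ cong just
    h : Fin (suc (4 * k + 2))
    h = half (q ⊖ p)
  partners-once nothing  (just q) _ = begin
    partnerCount _≟∞_ (roundsZ∞ I) nothing (just q)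
      ≡⟨ partnerCount-cyclic nothing (just q) ⟩
    ∞.partnerOrbit nothing (just q) (game∞ α) + ∑[ i < k ] ∞.partnerOrbit nothing (just q) (lookup I (suc i))
      ≡⟨ cong₂ _+_ (partnerOrbit-∞-game∞ q α)
                   (∑-0 λ i → trans (cong (∞.partnerOrbit nothing (just q)) (lookup-I i)) (partnerOrbit-∞-just q (game± (lookup S i)))) ⟩
    1 ∎
    where open ≡-Reasoning
  partners-once (just p) nothing X≢Y =
    trans (∞.partnerCount-sym (roundsZ∞ I) (just p) nothing) (partners-once nothing (just p) (X≢Y ∘ sym))

  opponents-twice : ∀ X Y → X ≢ Y → opponentCount _≟∞_ (roundsZ∞ I) X Y ≡ 2
  opponents-twice nothing  nothing  X≢Y = ⊥-elim (X≢Y refl)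
  opponents-twice (just p) (just q) X≢Y = begin
    opponentCount _≟∞_ (roundsZ∞ I) (just p) (just q)
      ≡⟨ opponentCount-cyclic (just p) (just q) ⟩
    ∞.opponentOrbit (just p) (just q) (game∞ α) + ∑[ i < k ] ∞.opponentOrbit (just p) (just q) (lookup I (suc i))
      ≡⟨ cong₂ _+_ (opponentOrbit-game∞ p≢q α) (sum-cong-≗ λ i → begin
           ∞.opponentOrbit (just p) (just q) (lookup I (suc i))                ≡⟨ cong (∞.opponentOrbit (just p) (just q)) (lookup-I i) ⟩
           ∞.opponentOrbit (just p) (just q) (mapGame just (game± (lookup S i))) ≡⟨ opponentOrbit-just p q (game± (lookup S i)) ⟩
           opponentOrbit p q (game± (lookup S i))                             ≡⟨ opponentOrbit-game± p≢q (proj₁ (lookup S i)) (proj₂ (lookup S i)) ⟩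
           2 * seats d (game± (diffSum (lookup S i)))                         ∎) ⟩
    2 * (𝟙 (d ≟ α) + 𝟙 (d ≟ ⊝ α)) + ∑[ i < k ] (2 * seats d (game± (diffSum (lookup S i))))
      ≡⟨ cong (2 * (𝟙 (d ≟ α) + 𝟙 (d ≟ ⊝ α)) +_) (trans (∑-*ˡ 2 (λ i → seats d (game± (diffSum (lookup S i))))) (cong (2 *_) (S±ᵈ.multiplicity d))) ⟩
    2 * (𝟙 (d ≟ α) + 𝟙 (d ≟ ⊝ α)) + 2 * 𝟙 (ordinary? d)
      ≡⟨ ℕP.*-distribˡ-+ 2 (𝟙 (d ≟ α) + 𝟙 (d ≟ ⊝ α)) (𝟙 (ordinary? d)) ⟨
    2 * (𝟙 (d ≟ α) + 𝟙 (d ≟ ⊝ α) + 𝟙 (ordinary? d))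
      ≡⟨ cong (2 *_) (nonzero-partition (λ q⊖p≡0 → p≢q (sym (⊖≡0⇒≡ q⊖p≡0)))) ⟩
    2 ∎
    where
    open ≡-Reasoning
    p≢q : p ≢ q
    p≢q = X≢Y ∘ cong just
    d : Fin (suc (4 * k + 2))
    d = q ⊖ p
  opponents-twice nothing  (just q) _ = begin
    opponentCount _≟∞_ (roundsZ∞ I) nothing (just q)
      ≡⟨ opponentCount-cyclic nothing (just q) ⟩
    ∞.opponentOrbit nothing (just q) (game∞ α) + ∑[ i < k ] ∞.opponentOrbit nothing (just q) (lookup I (suc i))
      ≡⟨ cong₂ _+_ (opponentOrbit-∞-game∞ q α)
                   (∑-0 λ i → trans (cong (∞.opponentOrbit nothing (just q)) (lookup-I i)) (opponentOrbit-∞-just q (game± (lookup S i)))) ⟩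
    2 ∎
    where open ≡-Reasoning
  opponents-twice (just p) nothing X≢Y =
    trans (∞.opponentCount-sym (roundsZ∞ I) (just p) nothing) (opponents-twice nothing (just p) (X≢Y ∘ sym))

  each-round-once : ∀ X r → gamesOf _≟∞_ (roundsZ∞ I) X r ≡ 1
  each-round-once nothing r = begin
    gamesOf _≟∞_ (roundsZ∞ I) nothing r
      ≡⟨ gamesOf-cyclic nothing r ⟩
    𝟙 (inGame? _≟∞_ nothing (mapGame (shift∞ r) (game∞ α))) + ∑[ i < k ] 𝟙 (inGame? _≟∞_ nothing (mapGame (shift∞ r) (lookup I (suc i))))
      ≡⟨ cong₂ _+_ (𝟙-yes (inj₁ refl) (inGame? _≟∞_ nothing (mapGame (shift∞ r) (game∞ α))))
                   (∑-0 λ i → 𝟙-no (∞∉ (game± (lookup S i)) ∘ subst (InGame nothing ∘ mapGame (shift∞ r)) (lookup-I i))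
                                   (inGame? _≟∞_ nothing (mapGame (shift∞ r) (lookup I (suc i))))) ⟩
    1 ∎
    where
    open ≡-Reasoning
    ∞∉ : ∀ G → ¬ InGame nothing (mapGame (shift∞ r) (mapGame just G))
    ∞∉ G (inj₁ ())
    ∞∉ G (inj₂ (inj₁ ()))
    ∞∉ G (inj₂ (inj₂ (inj₁ ())))
    ∞∉ G (inj₂ (inj₂ (inj₂ ())))
  each-round-once (just z) r = begin
    gamesOf _≟∞_ (roundsZ∞ I) (just z) r
      ≡⟨ gamesOf-cyclic (just z) r ⟩
    𝟙 (inGame? _≟∞_ (just z) (mapGame (shift∞ r) (game∞ α))) + ∑[ i < k ] 𝟙 (inGame? _≟∞_ (just z) (mapGame (shift∞ r) (lookup I (suc i))))
      ≡⟨ cong₂ _+_ (𝟙-cong in-game∞ (inGame? _≟∞_ (just z) (mapGame (shift∞ r) (game∞ α))) (exceptional? t))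
                   (sum-cong-≗ λ i → trans (cong (𝟙 ∘ inGame? _≟∞_ (just z) ∘ mapGame (shift∞ r)) (lookup-I i)) (in-base i)) ⟩
    𝟙 (exceptional? t) + ∑[ i < k ] seats t (game± (lookup S i))
      ≡⟨ cong (𝟙 (exceptional? t) +_) (S±.multiplicity t) ⟩
    𝟙 (exceptional? t) + 𝟙 (ordinary? t)
      ≡⟨ ℕP.+-comm (𝟙 (exceptional? t)) _ ⟩
    𝟙 (ordinary? t) + 𝟙 (exceptional? t)
      ≡⟨ 𝟙-complement (ordinary⇔¬exceptional t) (ordinary? t) (exceptional? t) ⟩
    1 ∎
    where
    open ≡-Reasoning
    t : Fin (suc (4 * k + 2))
    t = z ⊖ r
    untranslate : ∀ {a} → just z ≡ just (a ⊕ r) → t ≡ a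
    untranslate = Equivalence.to ≡⊕⇔⊖≡ ∘ MaybeP.just-injective
    retranslate : ∀ {a} → t ≡ a → just z ≡ just (a ⊕ r)
    retranslate = cong just ∘ Equivalence.from ≡⊕⇔⊖≡
    in-game∞ : InGame (just z) (mapGame (shift∞ r) (game∞ α)) ⇔ (t ≡ 0ᵥ ⊎ t ≡ α ⊎ t ≡ ⊝ α)
    in-game∞ = mk⇔ (λ { (inj₂ (inj₁ z∈)) → inj₂ (inj₁ (untranslate z∈)) ; (inj₂ (inj₂ (inj₁ z∈))) → inj₁ (untranslate z∈)
                      ; (inj₂ (inj₂ (inj₂ z∈))) → inj₂ (inj₂ (untranslate z∈)) })
                   (λ { (inj₁ t≡0) → inj₂ (inj₂ (inj₁ (retranslate t≡0))) ; (inj₂ (inj₁ t≡α)) → inj₂ (inj₁ (retranslate t≡α))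
                      ; (inj₂ (inj₂ t≡⊝α)) → inj₂ (inj₂ (inj₂ (retranslate t≡⊝α))) })
    in-base : ∀ i → 𝟙 (inGame? _≟∞_ (just z) (mapGame (shift∞ r) (mapGame just (game± (lookup S i))))) ≡ seats t (game± (lookup S i))
    in-base i = let G = mapGame (_⊕ r) (game± (lookup S i)) in
      trans (𝟙-cong (mk⇔ (inGame-map⁻ MaybeP.just-injective G) (inGame-map just G))
                    (inGame? _≟∞_ (just z) (mapGame just G)) (inGame? _≟_ z G))
            (𝟙-inGame-translate z r (game± (lookup S i)) (S±.seats≤1 t i))

  initial-partners : ∀ X Y → IsInitialPartnerPair I X Y ⇔ PartnerPair X Y
  initial-partners X Y = mk⇔ to from
    where
    to : IsInitialPartnerPair I X Y → PartnerPair X Y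
    to (zero , here X,Y≡∞,0)          = inj₂ X,Y≡∞,0
    to (zero , there (here X,Y≡±α))   = inj₁ (α , α≢0 , X,Y≡±α)
    to (suc i , X,Y∈Ii) with subst (Any (IsPair X Y) ∘ partnerPairs) (lookup-I i) X,Y∈Ii
    ... | here X,Y≡±x         = inj₁ (proj₁ (lookup S i) , proj₁ (S±.covered⇒A _ i (inj₁ refl)) , X,Y≡±x)
    ... | there (here X,Y≡±y) = inj₁ (proj₂ (lookup S i) , proj₁ (S±.covered⇒A _ i (inj₂ (inj₁ refl))) , X,Y≡±y)
    from : PartnerPair X Y → IsInitialPartnerPair I X Y
    from (inj₂ X,Y≡∞,0) = zero , here X,Y≡∞,0
    from (inj₁ (z , z≢0 , X,Y≡±z)) with z ≟ α | z ≟ ⊝ α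
    ... | yes refl | _         = zero , there (here X,Y≡±z)
    ... | no _     | yes z≡⊝α  = zero , there (here (isPair-±-flip just X,Y≡±z z≡⊝α))
    ... | no z≢α   | no z≢⊝α with Equivalence.from (proj₁ isAPS z) (z≢0 , z≢α , z≢⊝α)
    ...   | i , z∈±Si = suc i , subst (Any (IsPair X Y) ∘ partnerPairs) (sym (lookup-I i))
                                      (±pair⇒partner just (lookup S i) X,Y≡±z z∈±Si)

  zcps : IsZCPSWh-4k+4 k I
  zcps = ((distinct , partners-once , opponents-twice) , each-round-once) , initial-partners

module ZCPS⇒APS (k : ℕ) (I : Vec (Game (Maybe (Fin (suc (4 * k + 2))))) (suc k)) (zcps : IsZCPSWh-4k+4 k I) where

  open Residues-4k+3 k

  private
    distinct-round : ∀ r i → Distinct4 (lookup (roundsZ∞ I r) i)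
    distinct-round = proj₁ (proj₁ (proj₁ zcps))
    opponents-twice : ∀ X Y → X ≢ Y → opponentCount _≟∞_ (roundsZ∞ I) X Y ≡ 2
    opponents-twice = proj₂ (proj₂ (proj₁ (proj₁ zcps)))
    each-round-once : ∀ X r → gamesOf _≟∞_ (roundsZ∞ I) X r ≡ 1
    each-round-once = proj₂ (proj₁ zcps)
    initial-partners : ∀ X Y → IsInitialPartnerPair I X Y ⇔ PartnerPair X Y
    initial-partners = proj₂ zcps

  open Translates-∞ I

  round-0 : ∀ i → lookup (roundsZ∞ I 0ᵥ) i ≡ lookup I i
  round-0 i = trans (VecP.lookup-map i (translate∞ 0ᵥ) I) (mapGame-cong shift∞-0 (lookup I i))

  distinct : ∀ i → Distinct4 (lookup I i)
  distinct i = subst Distinct4 (round-0 i) (distinct-round 0ᵥ i)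

  same-game : ∀ {X i j} → InGame X (lookup I i) → InGame X (lookup I j) → i ≡ j
  same-game {X} {i} {j} X∈Ii X∈Ij with i FinP.≟ j
  ... | yes i≡j = i≡j
  ... | no  i≢j = ⊥-elim (2≰1 (begin
    2                                                                        ≡⟨⟩
    1 + 1                                                                    ≡⟨ cong₂ _+_ (𝟙-yes X∈Ii (inGame? _≟∞_ X (lookup I i))) (𝟙-yes X∈Ij (inGame? _≟∞_ X (lookup I j))) ⟨
    𝟙 (inGame? _≟∞_ X (lookup I i)) + 𝟙 (inGame? _≟∞_ X (lookup I j))     ≤⟨ ∑-≥-two (λ l → 𝟙 (inGame? _≟∞_ X (lookup I l))) i≢j ⟩
    ∑[ l < suc k ] 𝟙 (inGame? _≟∞_ X (lookup I l))                          ≡⟨ sum-cong-≗ (λ l → cong (𝟙 ∘ inGame? _≟∞_ X) (mapGame-cong shift∞-0 (lookup I l))) ⟨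
    ∑[ l < suc k ] 𝟙 (inGame? _≟∞_ X (mapGame (shift∞ 0ᵥ) (lookup I l)))    ≡⟨ gamesOf-cyclic X 0ᵥ ⟨
    gamesOf _≟∞_ (roundsZ∞ I) X 0ᵥ                                            ≡⟨ each-round-once X 0ᵥ ⟩
    1                                                                        ∎))
    where
    open ℕP.≤-Reasoning
    2≰1 : ¬ 2 ≤ 1
    2≰1 (s≤s ())

  record Like-game∞ (G : Game Player) : Set where
    field
      α         : Fin (suc (4 * k + 2))
      α≢0       : α ≢ 0ᵥ
      players   : ∀ X → InGame X G ⇔ InGame X (game∞ α)
      opponents : ∀ X Y → ∞.opponentOrbit X Y G ≡ ∞.opponentOrbit X Y (game∞ α)

  two-∞ : ∀ {A B C D Y Y′ : Player} → IsPair A C (nothing , Y) → IsPair B D (nothing , Y′) → ¬ Distinct4 (A , B , C , D)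
  two-∞ (inj₁ (refl , _)) (inj₁ (refl , _)) (a≢b , _)                       = a≢b refl
  two-∞ (inj₁ (refl , _)) (inj₂ (_ , refl)) (_ , _ , a≢d , _)               = a≢d refl
  two-∞ (inj₂ (_ , refl)) (inj₁ (refl , _)) (_ , _ , _ , b≢c , _)           = b≢c refl
  two-∞ (inj₂ (_ , refl)) (inj₂ (_ , refl)) (_ , _ , _ , _ , _ , c≢d)       = c≢d refl

  like-game∞ : ∀ {A B C D} → Distinct4 (A , B , C , D) →
               Any (IsPair nothing (just 0ᵥ)) (partnerPairs (A , B , C , D)) →
               PartnerPair A C → PartnerPair B D → Like-game∞ (A , B , C , D)
  like-game∞ dist (here ∞0≡AC) _ (inj₁ (x , x≢0 , BD≡±x)) = record
    { α = x ; α≢0 = x≢0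
    ; players   = λ X → inGame-partners {x = X} (isPair-flip ∞0≡AC) BD≡±x
    ; opponents = λ X Y → ∞.opponentOrbit-partners {X} {Y} (isPair-flip ∞0≡AC) BD≡±x }
  like-game∞ dist (here ∞0≡AC) _ (inj₂ BD≡∞0) = ⊥-elim (two-∞ (isPair-flip ∞0≡AC) BD≡∞0 dist)
  like-game∞ dist (there (here ∞0≡BD)) (inj₁ (x , x≢0 , AC≡±x)) _ = record
    { α = x ; α≢0 = x≢0
    ; players   = λ X → ⇔-trans (inGame-partners {x = X} AC≡±x (isPair-flip ∞0≡BD)) (inGame-swapSides (game∞ x))
    ; opponents = λ X Y → trans (∞.opponentOrbit-partners {X} {Y} AC≡±x (isPair-flip ∞0≡BD)) (∞.opponentOrbit-swapSides X Y (game∞ x)) }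
  like-game∞ dist (there (here ∞0≡BD)) (inj₂ AC≡∞0) _ = ⊥-elim (two-∞ AC≡∞0 (isPair-flip ∞0≡BD) dist)

  partnerPair-AC : ∀ i → PartnerPair (proj₁ (lookup I i)) (proj₁ (proj₂ (proj₂ (lookup I i))))
  partnerPair-AC i = Equivalence.to (initial-partners _ _) (i , here (inj₁ (refl , refl)))

  partnerPair-BD : ∀ i → PartnerPair (proj₁ (proj₂ (lookup I i))) (proj₂ (proj₂ (proj₂ (lookup I i))))
  partnerPair-BD i = Equivalence.to (initial-partners _ _) (i , there (here (inj₁ (refl , refl))))

  ∞-game : ∃[ j ] Any (IsPair nothing (just 0ᵥ)) (partnerPairs (lookup I j))
  ∞-game = Equivalence.from (initial-partners nothing (just 0ᵥ)) (inj₂ (inj₁ (refl , refl)))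

  j : Fin (suc k)
  j = proj₁ ∞-game

  like : Like-game∞ (lookup I j)
  like = like-game∞ (distinct j) (proj₂ ∞-game) (partnerPair-AC j) (partnerPair-BD j)

  open Like-game∞ like
  open Exceptional α α≢0 using (⊝α≢0)

  ∉game∞ : ∀ {z} → z ≢ α → z ≢ 0ᵥ → z ≢ ⊝ α → ¬ InGame (just z) (lookup I j)
  ∉game∞ {z} z≢α z≢0 z≢⊝α = ∉ ∘ Equivalence.to (players (just z))
    where
    ∉ : ¬ InGame (just z) (game∞ α)
    ∉ (inj₂ (inj₁ z≡α))         = z≢α (MaybeP.just-injective z≡α)
    ∉ (inj₂ (inj₂ (inj₁ z≡0)))  = z≢0 (MaybeP.just-injective z≡0)
    ∉ (inj₂ (inj₂ (inj₂ z≡⊝α))) = z≢⊝α (MaybeP.just-injective z≡⊝α)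

  ±pair-normal : ∀ {A C : Player} {x} → IsPair A C (just x , just (⊝ x)) → ∃[ a ] (A ≡ just a × C ≡ just (⊝ a))
  ±pair-normal {x = x} (inj₁ (A≡x , C≡⊝x)) = x , A≡x , C≡⊝x
  ±pair-normal {x = x} (inj₂ (A≡⊝x , C≡x)) = ⊝ x , A≡⊝x , trans C≡x (cong just (sym (⊝-involutive x)))

  -- Every other initial game avoids ∞, so both of its partner pairs have the form {x, -x}.
  -- The hypothesis i ≢ j is irrelevant, so that base i below does not depend on its proof.
  finite-game : ∀ i → .(i ≢ j) → ∃[ w ] lookup I i ≡ mapGame just (game± w)
  finite-game i i≢j with partnerPair-AC i | partnerPair-BD i
  ... | inj₂ AC≡∞0 | _ =
    ⊥-elim-irr (i≢j (same-game (partner⇒inGame (lookup I i) (here (isPair-flip AC≡∞0))) (Equivalence.from (players nothing) (inj₁ refl))))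
  ... | inj₁ _ | inj₂ BD≡∞0 =
    ⊥-elim-irr (i≢j (same-game (partner⇒inGame (lookup I i) (there (here (isPair-flip BD≡∞0)))) (Equivalence.from (players nothing) (inj₁ refl))))
  ... | inj₁ (_ , _ , AC≡±x) | inj₁ (_ , _ , BD≡±y)
    with ±pair-normal AC≡±x | ±pair-normal BD≡±y
  ...   | a , A≡a , C≡⊝a | b , B≡b , D≡⊝b = (a , b) , cong₂ _,_ A≡a (cong₂ _,_ B≡b (cong₂ _,_ C≡⊝a D≡⊝b))

  base : ∀ i → .(i ≢ j) → Fin (suc (4 * k + 2)) × Fin (suc (4 * k + 2))
  base i i≢j = proj₁ (finite-game i i≢j)

  lookup-I : ∀ i .(i≢j : i ≢ j) → lookup I i ≡ mapGame just (game± (base i i≢j))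
  lookup-I i i≢j = proj₂ (finite-game i i≢j)

  -- the games other than j, reindexed by Fin k
  S : Vec (Fin (suc (4 * k + 2)) × Fin (suc (4 * k + 2))) k
  S = Vec.tabulate (λ i′ → base (punchIn j i′) (FinP.punchInᵢ≢i j i′))

  lookup-S : ∀ {i} (i≢j : i ≢ j) → lookup S (punchOut (i≢j ∘ sym)) ≡ base i i≢j
  lookup-S {i} i≢j = trans (VecP.lookup∘tabulate _ (punchOut (i≢j ∘ sym))) (base-cong (FinP.punchIn-punchOut (i≢j ∘ sym)))
    where
    base-cong : ∀ {i₁ i₂} .{ne₁ : i₁ ≢ j} .{ne₂ : i₂ ≢ j} → i₁ ≡ i₂ → base i₁ ne₁ ≡ base i₂ ne₂
    base-cong refl = refl

  reindex : ∀ {P : Fin (suc (4 * k + 2)) × Fin (suc (4 * k + 2)) → Set} {i} (i≢j : i ≢ j) → P (base i i≢j) → ∃[ i′ ] P (lookup S i′)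
  reindex {P} i≢j p = punchOut (i≢j ∘ sym) , subst P (sym (lookup-S i≢j)) p

  lookup-S-punchIn : ∀ i′ → lookup S i′ ≡ base (punchIn j i′) (FinP.punchInᵢ≢i j i′)
  lookup-S-punchIn = VecP.lookup∘tabulate _

  ±-cover : ∀ z → (∃[ i′ ] z ∈± lookup S i′) ⇔ (z ≢ 0ᵥ × z ≢ α × z ≢ ⊝ α)
  ±-cover z = mk⇔ to from
    where
    to : ∃[ i′ ] z ∈± lookup S i′ → z ≢ 0ᵥ × z ≢ α × z ≢ ⊝ α
    to (i′ , z∈±) = avoids (inj₂ (inj₂ (inj₁ refl))) , avoids (inj₂ (inj₁ refl)) , avoids (inj₂ (inj₂ (inj₂ refl)))
      where
      i≢j : punchIn j i′ ≢ j
      i≢j = FinP.punchInᵢ≢i j i′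
      z∈Ii : InGame (just z) (lookup I (punchIn j i′))
      z∈Ii = subst (InGame (just z)) (sym (lookup-I _ i≢j))
                   (inGame-map just (game± (base _ i≢j)) (subst (z ∈±_) (lookup-S-punchIn i′) z∈±))
      avoids : ∀ {t} → InGame (just t) (game∞ α) → z ≢ t
      avoids t∈ refl = i≢j (same-game z∈Ii (Equivalence.from (players _) t∈))
    from : z ≢ 0ᵥ × z ≢ α × z ≢ ⊝ α → ∃[ i′ ] z ∈± lookup S i′
    from (z≢0 , z≢α , z≢⊝α) =
      let i , z,⊝z∈Ii = Equivalence.from (initial-partners (just z) (just (⊝ z))) (inj₁ (z , z≢0 , inj₁ (refl , refl)))
      in from-game i (partner⇒inGame (lookup I i) z,⊝z∈Ii) (i FinP.≟ j)
      where
      from-game : ∀ i → InGame (just z) (lookup I i) → Dec (i ≡ j) → ∃[ i′ ] z ∈± lookup S i′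
      from-game i z∈Ii (yes refl) = ⊥-elim (∉game∞ z≢α z≢0 z≢⊝α z∈Ii)
      from-game i z∈Ii (no i≢j)   = reindex {z ∈±_} i≢j (inGame-map⁻ MaybeP.just-injective (game± (base i i≢j))
                                      (subst (InGame (just z)) (lookup-I i i≢j) z∈Ii))

  opponentOrbit-base : ∀ {i} (i≢j : i ≢ j) {z} → 0ᵥ ≢ z →
                       ∞.opponentOrbit (just 0ᵥ) (just z) (lookup I i) ≡ 2 * seats z (game± (diffSum (base i i≢j)))
  opponentOrbit-base {i} i≢j {z} 0≢z = begin
    ∞.opponentOrbit (just 0ᵥ) (just z) (lookup I i)                        ≡⟨ cong (∞.opponentOrbit (just 0ᵥ) (just z)) (lookup-I i i≢j) ⟩
    ∞.opponentOrbit (just 0ᵥ) (just z) (mapGame just (game± (base i i≢j))) ≡⟨ opponentOrbit-just 0ᵥ z (game± (base i i≢j)) ⟩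
    opponentOrbit 0ᵥ z (game± (base i i≢j))                                ≡⟨ opponentOrbit-from-0 0≢z (base i i≢j) ⟩
    2 * seats z (game± (diffSum (base i i≢j)))                              ∎
    where open ≡-Reasoning

  opponentOrbit-j : ∀ {z} → 0ᵥ ≢ z → ∞.opponentOrbit (just 0ᵥ) (just z) (lookup I j) ≡ 2 * (𝟙 (z ≟ α) + 𝟙 (z ≟ ⊝ α))
  opponentOrbit-j {z} 0≢z = begin
    ∞.opponentOrbit (just 0ᵥ) (just z) (lookup I j)  ≡⟨ opponents (just 0ᵥ) (just z) ⟩
    ∞.opponentOrbit (just 0ᵥ) (just z) (game∞ α)     ≡⟨ opponentOrbit-game∞ 0≢z α ⟩
    2 * (𝟙 (z ⊖ 0ᵥ ≟ α) + 𝟙 (z ⊖ 0ᵥ ≟ ⊝ α))          ≡⟨ cong (λ t → 2 * (𝟙 (t ≟ α) + 𝟙 (t ≟ ⊝ α))) (⊖0ᵥ z) ⟩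
    2 * (𝟙 (z ≟ α) + 𝟙 (z ≟ ⊝ α))                    ∎
    where open ≡-Reasoning

  ±α≢0 : ∀ {β} → β ≡ α ⊎ β ≡ ⊝ α → 0ᵥ ≢ β
  ±α≢0 (inj₁ refl) 0≡α  = α≢0 (sym 0≡α)
  ±α≢0 (inj₂ refl) 0≡⊝α = ⊝α≢0 (sym 0≡⊝α)

  𝟙-±α : ∀ {β} → β ≡ α ⊎ β ≡ ⊝ α → 1 ≤ 𝟙 (β ≟ α) + 𝟙 (β ≟ ⊝ α)
  𝟙-±α {β} (inj₁ β≡α)  = ℕP.≤-trans (ℕP.≤-reflexive (sym (𝟙-yes β≡α (β ≟ α)))) (ℕP.m≤m+n _ _)
  𝟙-±α {β} (inj₂ β≡⊝α) = ℕP.≤-trans (ℕP.≤-reflexive (sym (𝟙-yes β≡⊝α (β ≟ ⊝ α)))) (ℕP.m≤n+m _ _)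

  -- ±α already occurs twice as a difference in game j, so no other game may produce it.
  ±α∉diffs : ∀ {β} → β ≡ α ⊎ β ≡ ⊝ α → ∀ {i} (i≢j : i ≢ j) → ¬ β ∈± diffSum (base i i≢j)
  ±α∉diffs {β} β≡±α {i} i≢j β∈± = 4≰2 (begin
    4                                                                    ≡⟨⟩
    2 * 1 + 2 * 1                                                        ≤⟨ ℕP.+-mono-≤ (ℕP.*-monoʳ-≤ 2 (𝟙-±α β≡±α)) (ℕP.*-monoʳ-≤ 2 (inGame⇒seats≥1 _ β∈±)) ⟩
    2 * (𝟙 (β ≟ α) + 𝟙 (β ≟ ⊝ α)) + 2 * seats β (game± (diffSum (base i i≢j)))
                                                                         ≡⟨ cong₂ _+_ (opponentOrbit-j 0≢β) (opponentOrbit-base i≢j 0≢β) ⟨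
    f j + f i                                                            ≤⟨ ∑-≥-two f (i≢j ∘ sym) ⟩
    ∑[ l < suc k ] f l                                                   ≡⟨ opponentCount-cyclic (just 0ᵥ) (just β) ⟨
    opponentCount _≟∞_ (roundsZ∞ I) (just 0ᵥ) (just β)                   ≡⟨ opponents-twice (just 0ᵥ) (just β) (0≢β ∘ MaybeP.just-injective) ⟩
    2                                                                    ∎)
    where
    open ℕP.≤-Reasoning
    f : Fin (suc k) → ℕ
    f l = ∞.opponentOrbit (just 0ᵥ) (just β) (lookup I l)
    0≢β : 0ᵥ ≢ β
    0≢β = ±α≢0 β≡±α
    4≰2 : ¬ 4 ≤ 2
    4≰2 (s≤s (s≤s ()))

  diff-cover : ∀ z → (∃[ i′ ] z ∈± diffSum (lookup S i′)) ⇔ (z ≢ 0ᵥ × z ≢ α × z ≢ ⊝ α)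
  diff-cover z = mk⇔ to from
    where
    to : ∃[ i′ ] z ∈± diffSum (lookup S i′) → z ≢ 0ᵥ × z ≢ α × z ≢ ⊝ α
    to (i′ , z∈±) = (λ { refl → 0∉±diffSum distinct-i z∈±′ }) ,
                    (λ { refl → ±α∉diffs (inj₁ refl) i≢j z∈±′ }) ,
                    (λ { refl → ±α∉diffs (inj₂ refl) i≢j z∈±′ })
      where
      i≢j : punchIn j i′ ≢ j
      i≢j = FinP.punchInᵢ≢i j i′
      z∈±′ : z ∈± diffSum (base _ i≢j)
      z∈±′ = subst (λ w → z ∈± diffSum w) (lookup-S-punchIn i′) z∈±
      distinct-i : Distinct4 (game± (base _ i≢j))
      distinct-i = distinct4-map⁻ just _ (subst Distinct4 (lookup-I _ i≢j) (distinct _))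
    from : z ≢ 0ᵥ × z ≢ α × z ≢ ⊝ α → ∃[ i′ ] z ∈± diffSum (lookup S i′)
    from (z≢0 , z≢α , z≢⊝α) =
      let i , pos = ∑-pos (λ l → ∞.opponentOrbit (just 0ᵥ) (just z) (lookup I l))
                          (subst (0 <_) (trans (sym (opponents-twice (just 0ᵥ) (just z) (z≢0 ∘ sym ∘ MaybeP.just-injective)))
                                               (opponentCount-cyclic (just 0ᵥ) (just z))) (s≤s z≤n))
      in from-game i pos (i FinP.≟ j)
      where
      from-game : ∀ i → 0 < ∞.opponentOrbit (just 0ᵥ) (just z) (lookup I i) → Dec (i ≡ j) → ∃[ i′ ] z ∈± diffSum (lookup S i′)
      from-game i pos (yes refl) = ⊥-elim (ℕP.<⇒≢ pos (sym (trans (opponentOrbit-j (z≢0 ∘ sym))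
                                     (cong₂ (λ s t → 2 * (s + t)) (𝟙-no z≢α (z ≟ α)) (𝟙-no z≢⊝α (z ≟ ⊝ α))))))
      from-game i pos (no i≢j)   = reindex {λ w → z ∈± diffSum w} i≢j (twice-seats-pos (game± (diffSum (base i i≢j)))
                                     (subst (0 <_) (opponentOrbit-base i≢j (z≢0 ∘ sym)) pos))

  aps : ∃[ α ] (α ≢ 0ᵥ × APS k α α)
  aps = α , α≢0 , S , ±-cover , diff-cover

proposition2p3 : (∀ (m : ℕ) → ZCPSWh-4m+1 m ⇔ PS m)
    × (∀ (k : ℕ) → ZCPSWh-4k+4 k ⇔ (∃[ α ] (α ≢ 0ᵥ × APS k α α)))
proposition2p3 =
  (λ m → mk⇔ (λ (I , zcps) → ZCPS⇒PS.S m I zcps , ZCPS⇒PS.ps m I zcps)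
             (λ (S , isPS) → PS⇒ZCPS.I m S isPS , PS⇒ZCPS.zcps m S isPS)) ,
  (λ k → mk⇔ (λ (I , zcps) → ZCPS⇒APS.aps k I zcps)
             (λ (α , α≢0 , S , isAPS) → APS⇒ZCPS.I k α α≢0 S isAPS , APS⇒ZCPS.zcps k α α≢0 S isAPS))
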